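{- Let $f:\{0,1\}^n\to\{0,1\}$ be a non-constant monotone Boolean function. Then \[ \mathrm{Arith}\big(\mathrm{Env}(\mathrm{Low}(f))\big)\leq \mathrm{Read}_1(f)\leq \mathrm{Lin}(f)=\mathrm{mLin}(f)\leq \mathrm{Arith}(\mathrm{Low}(f)). \] In particular, if $f$ is also homogeneous, then $\mathrm{Arith}(\mathrm{Low}(f))=\mathrm{Read}_1(f)=\mathrm{Lin}(f)=\mathrm{mLin}(f)$.
   Context: For monotone $f$, $\mathrm{Low}(f)$ is the set of $a\in\{0,1\}^n$ with $f(a)=1$ and $f(b)=0$ for all $b\leq a$, $b\neq a$; $f$ is homogeneous if all vectors of $\mathrm{Low}(f)$ have the same number of ones. A monotone Boolean circuit is a directed acyclic graph (parallel edges allowed) whose indegree-zero nodes hold variables among $x_1,\dots,x_n$ (no constants) and whose gates have indegree two and are labeled $\lor$ or $\land$; size = number of gates. The set $B_F\subseteq\mathbb{N}^n$ of exponent vectors produced by $F$: $B_{x_i}=\{e_i\}$, $B_{G\lor H}=B_G\cup B_H$, $B_{G\land H}=\{b+c:b\in B_G,c\in B_H\}$. A monotone circuit computing $f$ is read-$1$ if $\mathrm{Low}(f)\subseteq B_F$; $\mathrm{Read}_1(f)$ is the minimum size of such a circuit. A DeMorgan circuit is a $(\lor,\land)$ circuit whose inputs are the literals $x_1,\dots,x_n,\bar x_1,\dots,\bar x_n$. A Boolean function depends on $x_i$ if its value changes for some pair of inputs differing only in position $i$; two functions are independent if they depend on disjoint sets of variables. A (DeMorgan or monotone) circuit is multilinear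 if the two functions computed at the inputs of every AND gate are independent. $\mathrm{Lin}(f)$ is the minimum size of a multilinear DeMorgan circuit computing $f$; $\mathrm{mLin}(f)$ is the minimum size of a monotone multilinear circuit computing $f$. For finite $A\subseteq\mathbb{N}^n$, $\mathrm{Arith}(A)$ is the minimum size of a monotone arithmetic $(+,\times)$ circuit with only variables as inputs producing (as formal expansion, no cancellations) a polynomial $\sum_{a\in A}c_a\prod_ix_i^{a_i}$ with integers $c_a\geq1$. $\mathrm{Env}(A)$ is the set of vectors $a\in A$ of minimum degree $a_1+\dots+a_n$. -}

module Defs where

open import Data.Nat using (ℕ; zero; suc; _+_; _≤_)
open import Data.Bool using (Bool; true; false; not; if_then_else_)
  renaming (_≤_ to _≤ᵇ_)
open import Data.Fin using (Fin; zero; suc; _≟_)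
open import Data.Product using (Σ; ∃; ∃-syntax; _×_; _,_)
open import Data.Sum using (_⊎_; inj₁; inj₂)
open import Data.Unit using (⊤)
open import Data.List using (List; []; _∷_; _++_; concatMap; map)
open import Data.List.Relation.Unary.Any using (Any)
open import Relation.Nullary using (¬_; yes; no)
open import Relation.Binary.PropositionalEquality using (_≡_; _≢_)
open import Level using (Level)

BVec : ℕ → Set
BVec n = Fin n → Bool

NVec : ℕ → Set
NVec n = Fin n → ℕ

BoolFun : ℕ → Set
BoolFun n = BVec n → Bool

_≗ᵥ_ : ∀ {n} {A : Set} → (Fin n → A) → (Fin n → A) → Set
a ≗ᵥ b = ∀ i → a i ≡ b i

_≤ᵥ_ : ∀ {n} → BVec n → BVec n → Set
a ≤ᵥ b = ∀ i → a i ≤ᵇ b i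

Monotone : ∀ {n} → BoolFun n → Set
Monotone f = ∀ x y → x ≤ᵥ y → f x ≤ᵇ f y

NonConstant : ∀ {n} → BoolFun n → Set
NonConstant f = ∃[ x ] ∃[ y ] (f x ≢ f y)

b2n : Bool → ℕ
b2n false = 0
b2n true  = 1

toNVec : ∀ {n} → BVec n → NVec n
toNVec a i = b2n (a i)

degree : ∀ {n} → NVec n → ℕ
degree {zero}  a = 0
degree {suc n} a = a zero + degree (λ i → a (suc i))

Low : ∀ {n} → BoolFun n → BVec n → Set
Low f a = (f a ≡ true) × (∀ b → b ≤ᵥ a → ¬ (b ≗ᵥ a) → f b ≡ false)

LowN : ∀ {n} → BoolFun n → NVec n → Set
LowN f a = ∃[ b ] (Low f b × (a ≗ᵥ toNVec b))

Homogeneous : ∀ {n} → BoolFun n → Set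
Homogeneous f = ∀ a b → Low f a → Low f b → degree (toNVec a) ≡ degree (toNVec b)

Env : ∀ {n} → (NVec n → Set) → NVec n → Set
Env A a = A a × (∀ b → A b → degree a ≤ degree b)

flipAt : ∀ {n} → BVec n → Fin n → BVec n
flipAt x i j with j ≟ i
... | yes _ = not (x j)
... | no  _ = x j

DependsOn : ∀ {n} → BoolFun n → Fin n → Set
DependsOn g i = ∃[ x ] (g x ≢ g (flipAt x i))

Independent : ∀ {n} → BoolFun n → BoolFun n → Set
Independent g h = ∀ i → ¬ (DependsOn g i × DependsOn h i)

-- Circuits: DAGs given as a topologically ordered list of gates.
-- An input node holds a label of type L (variable or literal); gate k may
-- refer to input nodes and to gates 0..k-1.  Size = number of gates.

Ref : Set → ℕ → Set
Ref L k = L ⊎ Fin k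

data Gate (L O : Set) (k : ℕ) : Set where
  gate : O → Ref L k → Ref L k → Gate L O k

data Gates (L O : Set) : ℕ → Set where
  []  : Gates L O 0
  _▷_ : ∀ {k} → Gates L O k → Gate L O k → Gates L O (suc k)

record Circuit (L O : Set) (s : ℕ) : Set where
  constructor circuit
  field
    gates : Gates L O s
    out   : Ref L s
open Circuit public

eval : ∀ {ℓ} {L O : Set} {D : Set ℓ} → (L → D) → (O → D → D → D) →
       ∀ {k} → Gates L O k → Ref L k → D
eval lit op c (inj₁ l) = lit l
eval lit op (c ▷ gate o r₁ r₂) (inj₂ zero) = op o (eval lit op c r₁) (eval lit op c r₂)
eval lit op (c ▷ g) (inj₂ (suc i)) = eval lit op c (inj₂ i)

EveryGate : ∀ {ℓ} {L O : Set} {D : Set ℓ} → (L → D) → (O → D → D → D) →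
            (O → D → D → Set) → ∀ {k} → Gates L O k → Set
EveryGate lit op P [] = ⊤
EveryGate lit op P (c ▷ gate o r₁ r₂) =
  EveryGate lit op P c × P o (eval lit op c r₁) (eval lit op c r₂)

data BOp : Set where
  OR AND : BOp

boolOp : ∀ {n} → BOp → BoolFun n → BoolFun n → BoolFun n
boolOp OR  g h x = if g x then true else h x
boolOp AND g h x = if g x then h x else false

MonCircuit : ℕ → ℕ → Set
MonCircuit n s = Circuit (Fin n) BOp s

-- DeMorgan literals: (i , true) = xᵢ, (i , false) = x̄ᵢ
Literal : ℕ → Set
Literal n = Fin n × Bool

DMCircuit : ℕ → ℕ → Set
DMCircuit n s = Circuit (Literal n) BOp s

monLit : ∀ {n} → Fin n → BoolFun n
monLit i x = x i

dmLit : ∀ {n} → Literal n → BoolFun n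
dmLit (i , true)  x = x i
dmLit (i , false) x = not (x i)

monFun : ∀ {n s} → MonCircuit n s → BoolFun n
monFun C = eval monLit boolOp (gates C) (out C)

dmFun : ∀ {n s} → DMCircuit n s → BoolFun n
dmFun C = eval dmLit boolOp (gates C) (out C)

multCond : ∀ {n} → BOp → BoolFun n → BoolFun n → Set
multCond OR  g h = ⊤
multCond AND g h = Independent g h

MultilinearMon : ∀ {n s} → MonCircuit n s → Set
MultilinearMon C = EveryGate monLit boolOp multCond (gates C)

MultilinearDM : ∀ {n s} → DMCircuit n s → Set
MultilinearDM C = EveryGate dmLit boolOp multCond (gates C)

unitVec : ∀ {n} → Fin n → NVec n
unitVec i j with j ≟ i
... | yes _ = 1
... | no  _ = 0

BLit : ∀ {n} → Fin n → NVec n → Set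
BLit i b = b ≗ᵥ unitVec i

BOpSet : ∀ {n} → BOp → (NVec n → Set) → (NVec n → Set) → NVec n → Set
BOpSet OR  G H b = G b ⊎ H b
BOpSet AND G H b = ∃[ c ] ∃[ d ] (G c × H d × (∀ i → b i ≡ c i + d i))

Bset : ∀ {n s} → MonCircuit n s → NVec n → Set
Bset C = eval BLit BOpSet (gates C) (out C)

Computes : ∀ {n} → BoolFun n → BoolFun n → Set
Computes g f = ∀ x → g x ≡ f x

ReadOne : ∀ {n s} → BoolFun n → MonCircuit n s → Set
ReadOne f C = Computes (monFun C) f × (∀ a → Low f a → Bset C (toNVec a))

-- Monotone arithmetic circuits; a polynomial is kept as its formal
-- expansion: a list of monomials (exponent vectors), each with coefficient 1,
-- so the coefficient of x^a is the multiplicity of a in the list.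

data AOp : Set where
  PLUS TIMES : AOp

ArCircuit : ℕ → ℕ → Set
ArCircuit n s = Circuit (Fin n) AOp s

Poly : ℕ → Set
Poly n = List (NVec n)

arLit : ∀ {n} → Fin n → Poly n
arLit i = unitVec i ∷ []

arOp : ∀ {n} → AOp → Poly n → Poly n → Poly n
arOp PLUS  p q = p ++ q
arOp TIMES p q = concatMap (λ c → map (λ d i → c i + d i) q) p

poly : ∀ {n s} → ArCircuit n s → Poly n
poly C = eval arLit arOp (gates C) (out C)

-- the polynomial is Σ_{a ∈ A} c_a x^a with all c_a ≥ 1:
-- a monomial has positive coefficient iff its exponent is in A
Produces : ∀ {n s} → (NVec n → Set) → ArCircuit n s → Set
Produces A C = ∀ a → (A a → Any (λ m → m ≗ᵥ a) (poly C))
                   × (Any (λ m → m ≗ᵥ a) (poly C) → A a)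

IsMin : (ℕ → Set) → ℕ → Set
IsMin P m = P m × (∀ k → P k → m ≤ k)

Read₁ : ∀ {n} → BoolFun n → ℕ → Set
Read₁ f = IsMin (λ s → Σ (MonCircuit _ s) (ReadOne f))

Lin : ∀ {n} → BoolFun n → ℕ → Set
Lin f = IsMin (λ s → Σ (DMCircuit _ s) λ C → Computes (dmFun C) f × MultilinearDM C)

mLin : ∀ {n} → BoolFun n → ℕ → Set
mLin f = IsMin (λ s → Σ (MonCircuit _ s) λ C → Computes (monFun C) f × MultilinearMon C)

Arith : ∀ {n} → (NVec n → Set) → ℕ → Set
Arith {n} A = IsMin (λ s → Σ (ArCircuit n s) (Produces A))

-- Each inequality comes from converting circuits gate by gate without adding gates.
-- An arithmetic circuit for Low(f) becomes a monotone multilinear circuit for f by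
-- reading + as ∨ and × as ∧; a product of two polynomials sharing a variable is read
-- as ∨ instead, which is harmless because such a product only has monomials with an
-- exponent ≥ 2, while Low(f) consists of 0/1 vectors. A multilinear DeMorgan circuit
-- for monotone f becomes monotone by computing at every node the upward closure of its
-- function: negative literals become the constant 1, which is then eliminated, and the
-- closure commutes with ∧ on independent arguments; the output is not constant since
-- f is not. In a monotone multilinear circuit the minimal true points of an AND of
-- independent functions are sums of minimal true points of its arguments, so the
-- circuit is read-1. Keeping at every node of a read-1 circuit only the monomials of
-- least degree yields Env(Low(f)), which equals Low(f) when f is homogeneous. The
-- minimal sizes exist because each property of circuits of a fixed size is decidable.

module Submission where

open import Defs
open import Data.Nat using (ℕ; zero; suc; _+_; z≤n; s≤s; _≤_; _<_)
import Data.Nat.Properties as ℕₚ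
open import Data.Bool using (Bool; true; false; not; if_then_else_; _xor_; b≤b; f≤t)
  renaming (_≤_ to _≤ᵇ_)
import Data.Bool.Properties as Boolₚ
open import Data.Fin using (Fin; zero; suc; _≟_)
import Data.Fin.Properties as Finₚ
open import Data.Product using (Σ; ∃; ∃-syntax; _×_; _,_; proj₁; proj₂)
open import Data.Sum using (_⊎_; inj₁; inj₂; [_,_]′)
open import Data.Unit using (⊤; tt)
open import Data.List using (List; []; _∷_; _++_; map; filter)
open import Data.List.Relation.Unary.Any as Any using (Any; here; there)
import Data.List.Relation.Unary.Any.Properties as Anyₚ
open import Data.List.Relation.Unary.All as All using (All)
import Data.List.Relation.Unary.All.Properties as Allₚ
open import Data.List.Membership.Propositional using (_∈_; find; lose)
open import Data.Maybe using (Maybe; nothing; just)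
import Data.Vec.Functional as Vecᶠ
open import Data.List.Extrema.Nat using (argmin; argmin-sel; f[argmin]≤f[⊤]; f[argmin]≤f[xs])
import Data.Maybe as Maybe
open import Relation.Nullary using (¬_; yes; no; Dec; does; contradiction)
open import Relation.Nullary.Decidable
  using (map′; _×-dec_; _→-dec_; ¬?; dec-true; dec-false; decidable-stable)
open import Relation.Unary using (Decidable)
open import Function using (_∘_)
open import Data.Nat.Induction using (<-rec)
open import Algebra.Properties.CommutativeSemigroup ℕₚ.+-commutativeSemigroup using (interchange)
open import Relation.Binary using (tri<; tri≈; tri>)
open import Relation.Binary.PropositionalEquality
  using (_≡_; _≢_; refl; sym; trans; cong; cong₂; subst; subst₂; module ≡-Reasoning)

Searchable : Set → Set₁
Searchable A = ∀ (P : A → Set) → Decidable P → Dec (∃ P)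

search-Bool : Searchable Bool
search-Bool P P? with P? false | P? true
... | yes p | _     = yes (false , p)
... | no _  | yes q = yes (true , q)
... | no ¬p | no ¬q = no λ { (false , p) → ¬p p ; (true , q) → ¬q q }

search-Fin : ∀ n → Searchable (Fin n)
search-Fin n P P? = Finₚ.any? P?

search-Σ : ∀ {A : Set} {B : A → Set} → Searchable A → (∀ a → Searchable (B a)) → Searchable (Σ A B)
search-Σ {A} {B} sA sB P P? =
  map′ (λ (a , b , p) → (a , b) , p) (λ ((a , b) , p) → a , b , p)
       (sA (λ a → ∃ λ b → P (a , b)) (λ a → sB a (λ b → P (a , b)) (λ b → P? (a , b))))

search-⊎ : ∀ {A B : Set} → Searchable A → Searchable B → Searchable (A ⊎ B)
search-⊎ sA sB P P? with sA (λ a → P (inj₁ a)) (λ a → P? (inj₁ a)) | sB (λ b → P (inj₂ b)) (λ b → P? (inj₂ b))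
... | yes (a , p) | _           = yes (inj₁ a , p)
... | no _        | yes (b , p) = yes (inj₂ b , p)
... | no ¬p       | no ¬q       = no λ { (inj₁ a , p) → ¬p (a , p) ; (inj₂ b , p) → ¬q (b , p) }

search-onto : ∀ {A B : Set} → Searchable A → (f : A → B) → (∀ b → ∃ λ a → f a ≡ b) → Searchable B
search-onto sA f onto P P? =
  map′ (λ (a , p) → f a , p) (λ (b , p) → proj₁ (onto b) , subst P (sym (proj₂ (onto b))) p)
       (sA (λ a → P (f a)) (λ a → P? (f a)))

-- Functions are compared pointwise: there is no function extensionality.
Extensional : ∀ {n} {A : Set} → ((Fin n → A) → Set) → Set
Extensional P = ∀ {x y} → x ≗ᵥ y → P x → P y

search-→ : ∀ {A : Set} → Searchable A → ∀ n (P : (Fin n → A) → Set) → Extensional P →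
  Decidable P → Dec (∃ P)
search-→ sA zero P ext P? = map′ (λ p → Vecᶠ.[] , p) (λ (x , p) → ext (λ ()) p) (P? Vecᶠ.[])
search-→ sA (suc n) P ext P? =
  map′ (λ (a , t , p) → a Vecᶠ.∷ t , p) (λ (x , p) → x zero , Vecᶠ.tail x , ext split p)
       (sA (λ a → ∃ λ t → P (a Vecᶠ.∷ t))
           (λ a → search-→ sA n (λ t → P (a Vecᶠ.∷ t)) (λ e → ext (cons-cong e)) (λ t → P? (a Vecᶠ.∷ t))))
  where
  cons-cong : ∀ {a t t'} → t ≗ᵥ t' → (a Vecᶠ.∷ t) ≗ᵥ (a Vecᶠ.∷ t')
  cons-cong e zero    = refl
  cons-cong e (suc i) = e i
  split : ∀ {x} → x ≗ᵥ (x zero Vecᶠ.∷ Vecᶠ.tail x)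
  split zero    = refl
  split (suc i) = refl

∃-BVec? : ∀ n (P : BVec n → Set) → Extensional P → Decidable P → Dec (∃ P)
∃-BVec? = search-→ search-Bool

∀-BVec? : ∀ n (P : BVec n → Set) → Extensional P → Decidable P → Dec (∀ x → P x)
∀-BVec? n P ext P? =
  map′ (λ ¬∃¬ x → decidable-stable (P? x) λ ¬p → ¬∃¬ (x , ¬p)) (λ ∀p (x , ¬p) → ¬p (∀p x))
       (¬? (∃-BVec? n (λ x → ¬ P x) (λ e ¬p p → ¬p (ext (λ i → sym (e i)) p)) (λ x → ¬? (P? x))))

least : (P : ℕ → Set) → Decidable P → ∀ {w} → P w → ∃ (IsMin P)
least P P? {w} = <-rec (λ w → P w → ∃ (IsMin P)) step w
  where
  step : ∀ w → (∀ {k} → k < w → P k → ∃ (IsMin P)) → P w → ∃ (IsMin P)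
  step w below pw with ℕₚ.anyUpTo? P? w
  ... | yes (k , k<w , pk) = below k<w pk
  ... | no none            = w , pw , λ k pk → ℕₚ.≮⇒≥ (λ k<w → none (k , k<w , pk))

_≼_ : (ℕ → Set) → (ℕ → Set) → Set
P ≼ Q = ∀ {s} → P s → ∃[ k ] k ≤ s × Q k

IsMin-≼ : ∀ {P Q p q} → IsMin P p → IsMin Q q → P ≼ Q → q ≤ p
IsMin-≼ (pp , _) (_ , q-min) P≼Q = let (k , k≤p , qk) = P≼Q pp in ℕₚ.≤-trans (q-min k qk) k≤p

record LeastBelow (Q : ℕ → Set) (p : ℕ) : Set where
  field
    size  : ℕ
    isMin : IsMin Q size
    below : size ≤ p

least-≼ : ∀ {P Q p} → Decidable Q → P ≼ Q → IsMin P p → LeastBelow Q p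
least-≼ {Q = Q} Q? P≼Q isMin = record
  { size = proj₁ Q-least ; isMin = proj₂ Q-least ; below = IsMin-≼ isMin (proj₂ Q-least) P≼Q }
  where
  Q-least = least Q Q? (proj₂ (proj₂ (P≼Q (proj₁ isMin))))

≗ᵥ-sym : ∀ {n} {A : Set} {a b : Fin n → A} → a ≗ᵥ b → b ≗ᵥ a
≗ᵥ-sym e i = sym (e i)

≗ᵥ-trans : ∀ {n} {A : Set} {a b c : Fin n → A} → a ≗ᵥ b → b ≗ᵥ c → a ≗ᵥ c
≗ᵥ-trans e e' i = trans (e i) (e' i)

_+ᵥ_ : ∀ {n} → NVec n → NVec n → NVec n
(a +ᵥ b) i = a i + b i

_≤ₙ_ : ∀ {n} → NVec n → NVec n → Set
a ≤ₙ b = ∀ i → a i ≤ b i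

+-split-≡ : ∀ {x y u v} → x ≤ y → u ≤ v → x + u ≡ y + v → x ≡ y × u ≡ v
+-split-≡ {x} {y} {u} {v} x≤y u≤v e = x≡y , ℕₚ.+-cancelˡ-≡ x u v (trans e (cong (_+ v) (sym x≡y)))
  where
  x≡y : x ≡ y
  x≡y = ℕₚ.≤-antisym x≤y (ℕₚ.≮⇒≥ λ x<y → ℕₚ.<-irrefl e (ℕₚ.+-mono-<-≤ x<y u≤v))

degree-cong : ∀ {n} {a b : NVec n} → a ≗ᵥ b → degree a ≡ degree b
degree-cong {zero}  e = refl
degree-cong {suc n} e = cong₂ _+_ (e zero) (degree-cong (λ i → e (suc i)))

degree-+ᵥ : ∀ {n} (a b : NVec n) → degree (a +ᵥ b) ≡ degree a + degree b
degree-+ᵥ {zero}  a b = refl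
degree-+ᵥ {suc n} a b = trans (cong (a zero + b zero +_) (degree-+ᵥ (Vecᶠ.tail a) (Vecᶠ.tail b)))
  (interchange (a zero) (b zero) (degree (Vecᶠ.tail a)) (degree (Vecᶠ.tail b)))

degree-mono : ∀ {n} {a b : NVec n} → a ≤ₙ b → degree a ≤ degree b
degree-mono {zero}  le = z≤n
degree-mono {suc n} le = ℕₚ.+-mono-≤ (le zero) (degree-mono (λ i → le (suc i)))

degree-mono-≡ : ∀ {n} {a b : NVec n} → a ≤ₙ b → degree a ≡ degree b → a ≗ᵥ b
degree-mono-≡ {suc n} le e zero    = proj₁ (+-split-≡ (le zero) (degree-mono (λ i → le (suc i))) e)
degree-mono-≡ {suc n} le e (suc i) =
  degree-mono-≡ (λ i → le (suc i)) (proj₂ (+-split-≡ (le zero) (degree-mono (λ i → le (suc i))) e)) i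

b2n-injective : ∀ {a b} → b2n a ≡ b2n b → a ≡ b
b2n-injective {false} {false} _ = refl
b2n-injective {true}  {true}  _ = refl

b2n-mono : ∀ {a b} → a ≤ᵇ b → b2n a ≤ b2n b
b2n-mono b≤b = ℕₚ.≤-refl
b2n-mono f≤t = z≤n

b2n≤1 : ∀ b → b2n b ≤ 1
b2n≤1 false = z≤n
b2n≤1 true  = s≤s z≤n

1≤b2n⇒true : ∀ {b} → 1 ≤ b2n b → b ≡ true
1≤b2n⇒true {true} _ = refl

weight : ∀ {n} → BVec n → ℕ
weight x = degree (toNVec x)

weight-mono : ∀ {n} {a b : BVec n} → a ≤ᵥ b → weight a ≤ weight b
weight-mono le = degree-mono (λ i → b2n-mono (le i))

weight-mono-≡ : ∀ {n} {a b : BVec n} → a ≤ᵥ b → weight a ≡ weight b → a ≗ᵥ b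
weight-mono-≡ le e i = b2n-injective (degree-mono-≡ (λ i → b2n-mono (le i)) e i)

weight-mono-< : ∀ {n} {a b : BVec n} → a ≤ᵥ b → ¬ a ≗ᵥ b → weight a < weight b
weight-mono-< le ne = ℕₚ.≤∧≢⇒< (weight-mono le) (λ e → ne (weight-mono-≡ le e))

isPos : ℕ → Bool
isPos zero    = false
isPos (suc _) = true

support : ∀ {n} → NVec n → BVec n
support m i = isPos (m i)

b2n-isPos : ∀ k → b2n (isPos k) ≤ k
b2n-isPos zero    = z≤n
b2n-isPos (suc k) = s≤s z≤n

weight-support : ∀ {n} (m : NVec n) → weight (support m) ≤ degree m
weight-support m = degree-mono (λ i → b2n-isPos (m i))

weight-support-≡ : ∀ {n} (m : NVec n) → weight (support m) ≡ degree m → m ≗ᵥ toNVec (support m)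
weight-support-≡ m e = ≗ᵥ-sym (degree-mono-≡ (λ i → b2n-isPos (m i)) e)

unitVec-same : ∀ {n} (i : Fin n) → unitVec i i ≡ 1
unitVec-same i with i ≟ i
... | yes _ = refl
... | no i≢i = contradiction refl i≢i

unitVec-other : ∀ {n} {i j : Fin n} → j ≢ i → unitVec i j ≡ 0
unitVec-other {i = i} {j} j≢i with j ≟ i
... | yes j≡i = contradiction j≡i j≢i
... | no _ = refl

Congruent : ∀ {n} {A : Set} → (BVec n → A) → Set
Congruent g = ∀ {x y} → x ≗ᵥ y → g x ≡ g y

≗⇒≤ᵥ : ∀ {n} {x y : BVec n} → x ≗ᵥ y → x ≤ᵥ y
≗⇒≤ᵥ e i = Boolₚ.≤-reflexive (e i)

≤ᵥ-refl : ∀ {n} {x : BVec n} → x ≤ᵥ x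
≤ᵥ-refl i = Boolₚ.≤-refl

≤ᵥ-trans : ∀ {n} {a b c : BVec n} → a ≤ᵥ b → b ≤ᵥ c → a ≤ᵥ c
≤ᵥ-trans ab bc i = Boolₚ.≤-trans (ab i) (bc i)

≤ᵥ-resp-≗ : ∀ {n} {a a' b b' : BVec n} → a ≗ᵥ a' → b ≗ᵥ b' → a ≤ᵥ b → a' ≤ᵥ b'
≤ᵥ-resp-≗ ea eb le i = subst₂ _≤ᵇ_ (ea i) (eb i) (le i)

≤ᵥ-from-true : ∀ {n} {a b : BVec n} → (∀ i → a i ≡ true → b i ≡ true) → a ≤ᵥ b
≤ᵥ-from-true {a = a} {b} h i with a i in ai
... | false = Boolₚ.≤-minimum (b i)
... | true  = Boolₚ.≤-reflexive (sym (h i ai))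

_≤ᵥ?_ : ∀ {n} (x y : BVec n) → Dec (x ≤ᵥ y)
x ≤ᵥ? y = Finₚ.all? (λ i → x i Boolₚ.≤? y i)

_≗ᵥ?_ : ∀ {n} (x y : BVec n) → Dec (x ≗ᵥ y)
x ≗ᵥ? y = Finₚ.all? (λ i → x i Boolₚ.≟ y i)

allFalse : ∀ {n} → BVec n
allFalse _ = false

allFalse-≤ : ∀ {n} (x : BVec n) → allFalse ≤ᵥ x
allFalse-≤ x i = Boolₚ.≤-minimum (x i)

≤ᵇ-true : ∀ {a b} → a ≤ᵇ b → a ≡ true → b ≡ true
≤ᵇ-true b≤b e = e

≤ᵇ-false : ∀ {a} → a ≤ᵇ false → a ≡ false
≤ᵇ-false b≤b = refl

≢true⇒false : ∀ {b} → b ≢ true → b ≡ false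
≢true⇒false = Boolₚ.¬-not

true≢false : true ≢ false
true≢false ()

monotone⇒congruent : ∀ {n} {f : BoolFun n} → Monotone f → Congruent f
monotone⇒congruent mf e = Boolₚ.≤-antisym (mf _ _ (≗⇒≤ᵥ e)) (mf _ _ (≗⇒≤ᵥ (≗ᵥ-sym e)))

bool-ext : ∀ {a b : Bool} → (a ≡ true → b ≡ true) → (b ≡ true → a ≡ true) → a ≡ b
bool-ext {false} {false} _ _ = refl
bool-ext {false} {true}  _ h = h refl
bool-ext {true}  {false} h _ = sym (h refl)
bool-ext {true}  {true}  _ _ = refl

⟦_⟧ : BOp → Bool → Bool → Bool
⟦ OR  ⟧ a b = if a then true else b
⟦ AND ⟧ a b = if a then b else false

boolOp-pointwise : ∀ {n} o (g h : BoolFun n) x → boolOp o g h x ≡ ⟦ o ⟧ (g x) (h x)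
boolOp-pointwise OR  g h x = refl
boolOp-pointwise AND g h x = refl

boolOp-cong : ∀ {n} o {g g' h h' : BoolFun n} {x x'} → g x ≡ g' x' → h x ≡ h' x' →
  boolOp o g h x ≡ boolOp o g' h' x'
boolOp-cong o {g} {g'} {h} {h'} {x} {x'} eg eh = begin
  boolOp o g h x        ≡⟨ boolOp-pointwise o g h x ⟩
  ⟦ o ⟧ (g x) (h x)     ≡⟨ cong₂ ⟦ o ⟧ eg eh ⟩
  ⟦ o ⟧ (g' x') (h' x') ≡⟨ boolOp-pointwise o g' h' x' ⟨
  boolOp o g' h' x'     ∎
  where open ≡-Reasoning

⟦⟧-mono : ∀ o {a a' b b'} → a ≤ᵇ a' → b ≤ᵇ b' → ⟦ o ⟧ a b ≤ᵇ ⟦ o ⟧ a' b'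
⟦⟧-mono OR  {false} {false} _ bb = bb
⟦⟧-mono OR  {false} {true}  _ _  = Boolₚ.≤-maximum _
⟦⟧-mono OR  {true}  {true}  _ _  = b≤b
⟦⟧-mono AND {false}         _ _  = Boolₚ.≤-minimum _
⟦⟧-mono AND {true}  {true}  _ bb = bb

or-true⁻ : ∀ {n} (g h : BoolFun n) x → boolOp OR g h x ≡ true → g x ≡ true ⊎ h x ≡ true
or-true⁻ g h x e with g x
... | true  = inj₁ refl
... | false = inj₂ e

or-true⁺ : ∀ {n} (g h : BoolFun n) x → g x ≡ true ⊎ h x ≡ true → boolOp OR g h x ≡ true
or-true⁺ g h x (inj₁ e) rewrite e = refl
or-true⁺ g h x (inj₂ e) with g x
... | true  = refl
... | false = e

or-false⁻ : ∀ {n} (g h : BoolFun n) x → boolOp OR g h x ≡ false → g x ≡ false × h x ≡ false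
or-false⁻ g h x e with g x
... | false = refl , e

and-true⁻ : ∀ {n} (g h : BoolFun n) x → boolOp AND g h x ≡ true → g x ≡ true × h x ≡ true
and-true⁻ g h x e with g x
... | true = refl , e

and-true⁺ : ∀ {n} (g h : BoolFun n) x → g x ≡ true → h x ≡ true → boolOp AND g h x ≡ true
and-true⁺ g h x e e' rewrite e = e'

boolOp-congruent : ∀ {n} o {g h : BoolFun n} → Congruent g → Congruent h → Congruent (boolOp o g h)
boolOp-congruent o cg ch e = boolOp-cong o (cg e) (ch e)

flipAt-cong : ∀ {n} {x y : BVec n} i → x ≗ᵥ y → flipAt x i ≗ᵥ flipAt y i
flipAt-cong i e j with j ≟ i
... | yes _ = cong not (e j)
... | no _  = e j

flipAt-same : ∀ {n} (x : BVec n) i → flipAt x i i ≡ not (x i)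
flipAt-same x i with i ≟ i
... | yes _  = refl
... | no i≢i = contradiction refl i≢i

flipAt-other : ∀ {n} (x : BVec n) {i j} → j ≢ i → flipAt x i j ≡ x j
flipAt-other x {i} {j} j≢i with j ≟ i
... | yes j≡i = contradiction j≡i j≢i
... | no _    = refl

flipAt-≢ : ∀ {n} (x : BVec n) i → ¬ flipAt x i ≗ᵥ x
flipAt-≢ x i e = Boolₚ.not-¬ refl (sym (trans (sym (flipAt-same x i)) (e i)))

flipAt-true-≤ : ∀ {n} (x : BVec n) i → x i ≡ true → flipAt x i ≤ᵥ x
flipAt-true-≤ x i xi j with j ≟ i
... | yes refl rewrite xi = f≤t
... | no _ = Boolₚ.≤-refl

DependsOn-cong : ∀ {n} {g g' : BoolFun n} → (∀ x → g x ≡ g' x) → ∀ {i} → DependsOn g i → DependsOn g' i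
DependsOn-cong e (x , ne) = x , λ e' → ne (trans (e x) (trans e' (sym (e _))))

Independent-cong : ∀ {n} {g g' h h' : BoolFun n} → (∀ x → g x ≡ g' x) → (∀ x → h x ≡ h' x) →
  Independent g h → Independent g' h'
Independent-cong eg eh ind i (dg , dh) =
  ind i (DependsOn-cong (λ x → sym (eg x)) dg , DependsOn-cong (λ x → sym (eh x)) dh)

multCond-cong : ∀ {n} o {g g' h h' : BoolFun n} → (∀ x → g x ≡ g' x) → (∀ x → h x ≡ h' x) →
  multCond o g h → multCond o g' h'
multCond-cong OR  eg eh _   = tt
multCond-cong AND eg eh ind = Independent-cong eg eh ind

DependsOn-boolOp : ∀ {n} o (g h : BoolFun n) {i} → DependsOn (boolOp o g h) i → DependsOn g i ⊎ DependsOn h i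
DependsOn-boolOp o g h {i} (x , ne) with g x Boolₚ.≟ g (flipAt x i) | h x Boolₚ.≟ h (flipAt x i)
... | no ne' | _      = inj₁ (x , ne')
... | yes _  | no ne' = inj₂ (x , ne')
... | yes eg | yes eh = contradiction (boolOp-cong o eg eh) ne

DependsOn? : ∀ {n} {g : BoolFun n} → Congruent g → ∀ i → Dec (DependsOn g i)
DependsOn? {n} {g} cg i = ∃-BVec? n (λ x → g x ≢ g (flipAt x i))
  (λ e ne e' → ne (trans (cg e) (trans e' (cg (flipAt-cong i (≗ᵥ-sym e))))))
  (λ x → ¬? (g x Boolₚ.≟ g (flipAt x i)))

Independent? : ∀ {n} {g h : BoolFun n} → Congruent g → Congruent h → Dec (Independent g h)
Independent? cg ch = Finₚ.all? (λ i → ¬? (DependsOn? cg i ×-dec DependsOn? ch i))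

multCond? : ∀ {n} o {g h : BoolFun n} → Congruent g → Congruent h → Dec (multCond o g h)
multCond? OR  cg ch = yes tt
multCond? AND cg ch = Independent? cg ch

Computes? : ∀ {n} {g f : BoolFun n} → Congruent g → Congruent f → Dec (Computes g f)
Computes? {n} {g} {f} cg cf = ∀-BVec? n (λ x → g x ≡ f x)
  (λ e e' → trans (sym (cg e)) (trans e' (cf e))) (λ x → g x Boolₚ.≟ f x)

-- Flip the positions where x and y disagree one at a time; g depends on none of them.
congruent-on-dependencies : ∀ {n} {g : BoolFun n} → Congruent g → ∀ {x y} →
  (∀ i → DependsOn g i → x i ≡ y i) → g x ≡ g y
congruent-on-dependencies {n} {g} cg {x} {y} = go (suc (weight (diff x))) x (ℕₚ.n<1+n _)
  where
  diff : BVec n → BVec n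
  diff z i = z i xor y i

  disagree : ∀ {z} i → z i ≢ y i → diff z i ≡ true
  disagree {z} i ne = trans (cong (_xor y i) (Boolₚ.¬-not ne)) (Boolₚ.xor-inverseˡ (y i))

  flipped : ∀ z i → z i ≢ y i → diff (flipAt z i) i ≡ false
  flipped z i ne = begin
    flipAt z i i xor y i    ≡⟨ cong (_xor y i) (trans (flipAt-same z i) (cong not (Boolₚ.¬-not ne))) ⟩
    not (not (y i)) xor y i ≡⟨ cong (_xor y i) (Boolₚ.not-involutive (y i)) ⟩
    y i xor y i             ≡⟨ Boolₚ.xor-same (y i) ⟩
    false                   ∎
    where open ≡-Reasoning

  diff-flip-≤ : ∀ z i → z i ≢ y i → diff (flipAt z i) ≤ᵥ diff z
  diff-flip-≤ z i ne j with i ≟ j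
  ... | yes refl = subst (_≤ᵇ diff z i) (sym (flipped z i ne)) (Boolₚ.≤-minimum _)
  ... | no i≢j   = Boolₚ.≤-reflexive (cong (_xor y j) (flipAt-other z (i≢j ∘ sym)))

  diff-flip-≢ : ∀ z i → z i ≢ y i → ¬ diff (flipAt z i) ≗ᵥ diff z
  diff-flip-≢ z i ne e = true≢false (trans (sym (disagree {z} i ne)) (trans (sym (e i)) (flipped z i ne)))

  go : ∀ k z → weight (diff z) < k → (∀ i → DependsOn g i → z i ≡ y i) → g z ≡ g y
  go (suc k) z lt agree with Finₚ.any? (λ i → ¬? (z i Boolₚ.≟ y i))
  ... | no none = cg (λ i → decidable-stable (z i Boolₚ.≟ y i) (λ ne → none (i , ne)))
  ... | yes (i , ne) = trans g-flip (go k (flipAt z i) fewer agree′)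
    where
    g-flip : g z ≡ g (flipAt z i)
    g-flip = decidable-stable (g z Boolₚ.≟ g (flipAt z i)) (λ ne′ → ne (agree i (z , ne′)))
    fewer : weight (diff (flipAt z i)) < k
    fewer = ℕₚ.<-≤-trans (weight-mono-< (diff-flip-≤ z i ne) (diff-flip-≢ z i ne)) (ℕₚ.≤-pred lt)
    agree′ : ∀ j → DependsOn g j → flipAt z i j ≡ y j
    agree′ j dj with i ≟ j
    ... | yes refl = contradiction (agree j dj) ne
    ... | no i≢j   = trans (flipAt-other z (i≢j ∘ sym)) (agree j dj)

eval-congruent : ∀ {n} {L : Set} {lit : L → BoolFun n} → (∀ l → Congruent (lit l)) →
  ∀ {k} (c : Gates L BOp k) r → Congruent (eval lit boolOp c r)
eval-congruent cl c (inj₁ l) = cl l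
eval-congruent cl (c ▷ gate o r₁ r₂) (inj₂ zero) =
  boolOp-congruent o (eval-congruent cl c r₁) (eval-congruent cl c r₂)
eval-congruent cl (c ▷ gate _ _ _) (inj₂ (suc j)) = eval-congruent cl c (inj₂ j)

monLit-congruent : ∀ {n} (i : Fin n) → Congruent (monLit i)
monLit-congruent i e = e i

dmLit-congruent : ∀ {n} (l : Literal n) → Congruent (dmLit l)
dmLit-congruent (i , true)  e = e i
dmLit-congruent (i , false) e = cong not (e i)

eval-monotone : ∀ {n k} (c : Gates (Fin n) BOp k) r → Monotone (eval monLit boolOp c r)
eval-monotone c (inj₁ l) x y le = le l
eval-monotone (c ▷ gate o r₁ r₂) (inj₂ zero) x y le =
  subst₂ _≤ᵇ_ (sym (boolOp-pointwise o _ _ x)) (sym (boolOp-pointwise o _ _ y))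
    (⟦⟧-mono o (eval-monotone c r₁ x y le) (eval-monotone c r₂ x y le))
eval-monotone (c ▷ gate _ _ _) (inj₂ (suc j)) = eval-monotone c (inj₂ j)

EveryGate? : ∀ {ℓ} {L O : Set} {D : Set ℓ} {lit : L → D} {op : O → D → D → D} (P : O → D → D → Set) →
  (∀ {k} (c : Gates L O k) o r₁ r₂ → Dec (P o (eval lit op c r₁) (eval lit op c r₂))) →
  ∀ {k} (c : Gates L O k) → Dec (EveryGate lit op P c)
EveryGate? P P? [] = yes tt
EveryGate? P P? (c ▷ gate o r₁ r₂) = EveryGate? P P? c ×-dec P? c o r₁ r₂

multilinear? : ∀ {n} {L : Set} {lit : L → BoolFun n} → (∀ l → Congruent (lit l)) →
  ∀ {k} (c : Gates L BOp k) → Dec (EveryGate lit boolOp multCond c)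
multilinear? cl = EveryGate? multCond λ c o r₁ r₂ → multCond? o (eval-congruent cl c r₁) (eval-congruent cl c r₂)

EveryGate-⊤ : ∀ {ℓ} {L O : Set} {D : Set ℓ} (lit : L → D) (op : O → D → D → D) →
  ∀ {k} (c : Gates L O k) → EveryGate lit op (λ _ _ _ → ⊤) c
EveryGate-⊤ lit op [] = tt
EveryGate-⊤ lit op (c ▷ gate _ _ _) = EveryGate-⊤ lit op c , tt

weakenRef : ∀ {L : Set} {k} → Ref L k → Ref L (suc k)
weakenRef (inj₁ l) = inj₁ l
weakenRef (inj₂ j) = inj₂ (suc j)

eval-weakenRef : ∀ {ℓ} {L O : Set} {D : Set ℓ} (lit : L → D) (op : O → D → D → D) {k}
  (c : Gates L O k) g r → eval lit op (c ▷ g) (weakenRef r) ≡ eval lit op c r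
eval-weakenRef lit op c (gate _ _ _) (inj₁ l) = refl
eval-weakenRef lit op c (gate _ _ _) (inj₂ j) = refl

-- A gate-by-gate translation of source circuits (inputs L, gates O) into target
-- circuits (inputs L', gates O'). Once k target gates are built, a source node is
-- mapped to some Node k; each source gate either reuses such a node (inj₁) or
-- emits exactly one target gate (inj₂), so the target is never larger.
module Translation {L O L' O' D E : Set}
  (litD : L → D) (opD : O → D → D → D) (litE : L' → E) (opE : O' → E → E → E)
  (Node : ℕ → Set) (weaken : ∀ {k} → Node k → Node (suc k)) (newest : ∀ {k} → Node (suc k))
  (input : ∀ {k} → L → Node k)
  (step : ∀ {k} → O → D → D → Node k → Node k → Node k ⊎ (O' × Ref L' k × Ref L' k)) where

  record Translated (k : ℕ) : Set where
    constructor translated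
    field
      size  : ℕ
      size≤ : size ≤ k
      gs    : Gates L' O' size
      node  : Ref L k → Node size

  extend : ∀ {k} (T : Translated k) → let s = Translated.size T in Node s ⊎ (O' × Ref L' s × Ref L' s) →
    Translated (suc k)
  extend (translated s le gs m) (inj₁ v) =
    translated s (ℕₚ.m≤n⇒m≤1+n le) gs λ { (inj₁ l) → input l ; (inj₂ zero) → v ; (inj₂ (suc j)) → m (inj₂ j) }
  extend (translated s le gs m) (inj₂ (o' , s₁ , s₂)) =
    translated (suc s) (s≤s le) (gs ▷ gate o' s₁ s₂)
      λ { (inj₁ l) → input l ; (inj₂ zero) → newest ; (inj₂ (suc j)) → weaken (m (inj₂ j)) }

  translate : ∀ {k} → Gates L O k → Translated k
  translate [] = translated 0 z≤n [] λ { (inj₁ l) → input l ; (inj₂ ()) }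
  translate (c ▷ gate o r₁ r₂) = extend (translate c)
    (step o (eval litD opD c r₁) (eval litD opD c r₂) (node r₁) (node r₂))
    where open Translated (translate c)

  -- R d c v: the target node v of the target gates c simulates the source value d.
  module Sound (R : D → ∀ {k} → Gates L' O' k → Node k → Set)
    (Q : O → D → D → Set) (P : O' → E → E → Set)
    (R-weaken : ∀ {d k} {c : Gates L' O' k} {g v} → R d c v → R d (c ▷ g) (weaken v))
    (R-input : ∀ l {k} (c : Gates L' O' k) → R (litD l) c (input l)) where

    StepSpec : ∀ {k} → O → D → D → (c : Gates L' O' k) → Node k ⊎ (O' × Ref L' k × Ref L' k) → Set
    StepSpec o d₁ d₂ c (inj₁ v) = R (opD o d₁ d₂) c v
    StepSpec o d₁ d₂ c (inj₂ (o' , s₁ , s₂)) =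
      R (opD o d₁ d₂) (c ▷ gate o' s₁ s₂) newest × P o' (eval litE opE c s₁) (eval litE opE c s₂)

    StepSound : Set
    StepSound = ∀ {k} o d₁ d₂ (c : Gates L' O' k) v₁ v₂ → R d₁ c v₁ → R d₂ c v₂ → Q o d₁ d₂ →
      StepSpec o d₁ d₂ c (step o d₁ d₂ v₁ v₂)

    Simulates : ∀ {k} → Gates L O k → Translated k → Set
    Simulates c (translated s le gs m) = EveryGate litE opE P gs × (∀ r → R (eval litD opD c r) gs (m r))

    extend-sound : ∀ {k} (c : Gates L O k) o r₁ r₂ (T : Translated k) → Simulates c T → ∀ x →
      StepSpec o (eval litD opD c r₁) (eval litD opD c r₂) (Translated.gs T) x →
      Simulates (c ▷ gate o r₁ r₂) (extend T x)
    extend-sound c o r₁ r₂ (translated s le gs m) (eg , rr) (inj₁ v) sp =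
      eg , λ { (inj₁ l) → R-input l gs ; (inj₂ zero) → sp ; (inj₂ (suc j)) → rr (inj₂ j) }
    extend-sound c o r₁ r₂ (translated s le gs m) (eg , rr) (inj₂ _) (sp , p) =
      (eg , p) , λ { (inj₁ l) → R-input l _ ; (inj₂ zero) → sp ; (inj₂ (suc j)) → R-weaken (rr (inj₂ j)) }

    translate-sound : StepSound → ∀ {k} (c : Gates L O k) → EveryGate litD opD Q c → Simulates c (translate c)
    translate-sound ok [] _ = tt , λ { (inj₁ l) → R-input l [] ; (inj₂ ()) }
    translate-sound ok (c ▷ gate o r₁ r₂) (qc , q) with translate c | translate-sound ok c qc
    ... | T@(translated s le gs m) | sim@(_ , rr) =
      extend-sound c o r₁ r₂ T sim (step o _ _ (m r₁) (m r₂)) (ok o _ _ gs (m r₁) (m r₂) (rr r₁) (rr r₂) q)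

module _ {n} {f : BoolFun n} (cf : Congruent f) where

  Low-cong : ∀ {a a'} → a ≗ᵥ a' → Low f a → Low f a'
  Low-cong e (fa , minimal) =
    trans (cf (≗ᵥ-sym e)) fa , λ b le ne → minimal b (≤ᵥ-resp-≗ (λ _ → refl) (≗ᵥ-sym e) le) (λ e′ → ne (≗ᵥ-trans e′ e))

  Low? : ∀ a → Dec (Low f a)
  Low? a = (f a Boolₚ.≟ true) ×-dec ∀-BVec? n (λ b → b ≤ᵥ a → ¬ b ≗ᵥ a → f b ≡ false)
    (λ e h le ne → trans (cf (≗ᵥ-sym e)) (h (≤ᵥ-resp-≗ (≗ᵥ-sym e) (λ _ → refl) le) (ne ∘ ≗ᵥ-trans (≗ᵥ-sym e))))
    (λ b → b ≤ᵥ? a →-dec (¬? (b ≗ᵥ? a) →-dec (f b Boolₚ.≟ false)))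

  Low-below : ∀ x → f x ≡ true → ∃[ a ] a ≤ᵥ x × Low f a
  Low-below x = go (suc (weight x)) x (ℕₚ.n<1+n _)
    where
    go : ∀ k x → weight x < k → f x ≡ true → ∃[ a ] a ≤ᵥ x × Low f a
    go (suc k) x lt fx with ∃-BVec? n (λ b → b ≤ᵥ x × ¬ b ≗ᵥ x × f b ≡ true)
        (λ e (le , ne , fb) → ≤ᵥ-resp-≗ e (λ _ → refl) le , ne ∘ ≗ᵥ-trans e , trans (cf (≗ᵥ-sym e)) fb)
        (λ b → b ≤ᵥ? x ×-dec ¬? (b ≗ᵥ? x) ×-dec (f b Boolₚ.≟ true))
    ... | no none = x , ≤ᵥ-refl , fx , λ b le ne → ≢true⇒false (λ fb → none (b , le , ne , fb))
    ... | yes (b , le , ne , fb) =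
      let (a , a≤b , la) = go k b (ℕₚ.<-≤-trans (weight-mono-< le ne) (ℕₚ.≤-pred lt)) fb
      in a , ≤ᵥ-trans a≤b le , la

  LowN-cong : ∀ {a a'} → a ≗ᵥ a' → LowN f a → LowN f a'
  LowN-cong e (b , lb , eb) = b , lb , ≗ᵥ-trans (≗ᵥ-sym e) eb

  LowN? : ∀ a → Dec (LowN f a)
  LowN? a = ∃-BVec? n (λ b → Low f b × a ≗ᵥ toNVec b)
    (λ e (lb , eb) → Low-cong e lb , λ i → trans (eb i) (cong b2n (e i)))
    (λ b → Low? b ×-dec Finₚ.all? (λ i → a i ℕₚ.≟ toNVec b i))

  Env-cong : ∀ {a a'} → a ≗ᵥ a' → Env (LowN f) a → Env (LowN f) a'
  Env-cong e (la , below) = LowN-cong e la , λ b lb → subst (_≤ degree b) (degree-cong e) (below b lb)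

  Env? : ∀ a → Dec (Env (LowN f) a)
  Env? a = LowN? a ×-dec map′ over-LowN over-Low
    (∀-BVec? n (λ x → Low f x → degree a ≤ weight x)
       (λ e h lx → subst (degree a ≤_) (degree-cong (λ i → cong b2n (e i))) (h (Low-cong (≗ᵥ-sym e) lx)))
       (λ x → Low? x →-dec (degree a ℕₚ.≤? weight x)))
    where
    over-LowN : (∀ x → Low f x → degree a ≤ weight x) → ∀ b → LowN f b → degree a ≤ degree b
    over-LowN h b (x , lx , eb) = subst (degree a ≤_) (sym (degree-cong eb)) (h x lx)
    over-Low : (∀ b → LowN f b → degree a ≤ degree b) → ∀ x → Low f x → degree a ≤ weight x
    over-Low h x lx = h (toNVec x) (x , lx , λ _ → refl)

Low-upward : ∀ {n} {f : BoolFun n} → Monotone f → ∀ {a x} → Low f a → a ≤ᵥ x → f x ≡ true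
Low-upward mf (fa , _) le = ≤ᵇ-true (mf _ _ le) fa

Low-computes : ∀ {n} {g f : BoolFun n} → Computes g f → ∀ {a} → Low f a → Low g a
Low-computes comp (fa , minimal) = trans (comp _) fa , λ b le ne → trans (comp b) (minimal b le ne)

_*ₚ_ : ∀ {n} → Poly n → Poly n → Poly n
_*ₚ_ = arOp TIMES

Occurs : ∀ {n} → NVec n → Poly n → Set
Occurs a p = Any (_≗ᵥ a) p

NonEmpty : ∀ {A : Set} → List A → Set
NonEmpty p = ∃ (_∈ p)

Any-*ₚ⁻ : ∀ {n} {P : NVec n → Set} (p q : Poly n) → Any P (p *ₚ q) → Any (λ c → Any (λ d → P (c +ᵥ d)) q) p
Any-*ₚ⁻ p q a = Any.map Anyₚ.map⁻ (Anyₚ.concatMap⁻ _ a)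

Any-*ₚ⁺ : ∀ {n} {P : NVec n → Set} (p q : Poly n) → Any (λ c → Any (λ d → P (c +ᵥ d)) q) p → Any P (p *ₚ q)
Any-*ₚ⁺ p q a = Anyₚ.concatMap⁺ _ (Any.map Anyₚ.map⁺ a)

∈-*ₚ⁺ : ∀ {n} {p q : Poly n} {c d} → c ∈ p → d ∈ q → (c +ᵥ d) ∈ p *ₚ q
∈-*ₚ⁺ {p = p} {q} c∈p d∈q = Any-*ₚ⁺ p q (Any.map (λ { refl → Any.map (λ { refl → refl }) d∈q }) c∈p)

∈-*ₚ⁻ : ∀ {n} (p q : Poly n) {m} → m ∈ p *ₚ q → ∃[ c ] ∃[ d ] c ∈ p × d ∈ q × m ≡ c +ᵥ d
∈-*ₚ⁻ p q m∈ =
  let (c , c∈p , a) = find (Any-*ₚ⁻ p q m∈) ; (d , d∈q , e) = find a in c , d , c∈p , d∈q , e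

NonEmpty-*ₚ : ∀ {n} {p q : Poly n} → NonEmpty p → NonEmpty q → NonEmpty (p *ₚ q)
NonEmpty-*ₚ (c , c∈p) (d , d∈q) = c +ᵥ d , ∈-*ₚ⁺ c∈p d∈q

∈⇒Occurs : ∀ {n} {a : NVec n} {p} → a ∈ p → Occurs a p
∈⇒Occurs = Any.map (λ { refl _ → refl })

Occurs-cong : ∀ {n} {a a' : NVec n} {p} → a ≗ᵥ a' → Occurs a p → Occurs a' p
Occurs-cong e = Any.map (λ e′ → ≗ᵥ-trans e′ e)

Occurs-singleton : ∀ {n} {a m : NVec n} → Occurs a (m ∷ []) → m ≗ᵥ a
Occurs-singleton (here e) = e

Occurs? : ∀ {n} (a : NVec n) p → Dec (Occurs a p)
Occurs? a p = Any.any? (λ m → Finₚ.all? (λ i → m i ℕₚ.≟ a i)) p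

Occurs-*ₚ⁺ : ∀ {n} {c d m : NVec n} (p q : Poly n) → Occurs c p → Occurs d q → (c +ᵥ d) ≗ᵥ m → Occurs m (p *ₚ q)
Occurs-*ₚ⁺ p q oc od e =
  Any-*ₚ⁺ p q (Any.map (λ ec → Any.map (λ ed i → trans (cong₂ _+_ (ec i) (ed i)) (e i)) od) oc)

Occurs-*ₚ⁻ : ∀ {n} {m : NVec n} (p q : Poly n) → Occurs m (p *ₚ q) →
  ∃[ c ] ∃[ d ] c ∈ p × d ∈ q × (c +ᵥ d) ≗ᵥ m
Occurs-*ₚ⁻ p q o =
  let (c , c∈p , a) = find (Any-*ₚ⁻ p q o) ; (d , d∈q , e) = find a in c , d , c∈p , d∈q , e

ArithCircuits : ∀ {n} → (NVec n → Set) → ℕ → Set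
ArithCircuits {n} A s = Σ (ArCircuit n s) (Produces A)

ReadOneCircuits : ∀ {n} → BoolFun n → ℕ → Set
ReadOneCircuits f s = Σ (MonCircuit _ s) (ReadOne f)

MultilinearDMCircuits : ∀ {n} → BoolFun n → ℕ → Set
MultilinearDMCircuits f s = Σ (DMCircuit _ s) λ C → Computes (dmFun C) f × MultilinearDM C

MultilinearMonCircuits : ∀ {n} → BoolFun n → ℕ → Set
MultilinearMonCircuits f s = Σ (MonCircuit _ s) λ C → Computes (monFun C) f × MultilinearMon C

-- mLin(f) ≤ Arith(Low(f))

_⊑_ : ∀ {n} → NVec n → BVec n → Set
m ⊑ x = ∀ i → 1 ≤ m i → x i ≡ true

Mentions : ∀ {n} → Fin n → Poly n → Set
Mentions i p = Any (λ m → 1 ≤ m i) p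

ZeroOne : ∀ {n} → Poly n → Set
ZeroOne p = All (λ m → ∀ i → m i ≤ 1) p

Share : ∀ {n} → Poly n → Poly n → Set
Share {n} p q = ∃[ i ] Mentions i p × Mentions i q

Share? : ∀ {n} (p q : Poly n) → Dec (Share p q)
Share? p q = Finₚ.any? (λ i → Any.any? (λ m → 1 ℕₚ.≤? m i) p ×-dec Any.any? (λ m → 1 ℕₚ.≤? m i) q)

⊑-+ᵥ⁻ : ∀ {n} {c d : NVec n} {x} → (c +ᵥ d) ⊑ x → c ⊑ x × d ⊑ x
⊑-+ᵥ⁻ {c = c} {d} h = (λ i le → h i (ℕₚ.≤-trans le (ℕₚ.m≤m+n (c i) (d i))))
                     , (λ i le → h i (ℕₚ.≤-trans le (ℕₚ.m≤n+m (d i) (c i))))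

⊑-+ᵥ⁺ : ∀ {n} {c d : NVec n} {x} → c ⊑ x → d ⊑ x → (c +ᵥ d) ⊑ x
⊑-+ᵥ⁺ {c = c} hc hd i le with c i in ci
... | zero  = hd i le
... | suc _ = hc i (subst (1 ≤_) (sym ci) (s≤s z≤n))

Any⊑-*ₚ⁻ : ∀ {n} (p q : Poly n) {x} → Any (_⊑ x) (p *ₚ q) → Any (_⊑ x) p × Any (_⊑ x) q
Any⊑-*ₚ⁻ p q a with find a
... | m , m∈ , m⊑x with ∈-*ₚ⁻ p q m∈
...   | c , d , c∈p , d∈q , refl = lose c∈p (proj₁ (⊑-+ᵥ⁻ m⊑x)) , lose d∈q (proj₂ (⊑-+ᵥ⁻ m⊑x))

Any⊑-*ₚ⁺ : ∀ {n} (p q : Poly n) {x} → Any (_⊑ x) p → Any (_⊑ x) q → Any (_⊑ x) (p *ₚ q)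
Any⊑-*ₚ⁺ p q ap aq =
  let (c , c∈p , c⊑x) = find ap ; (d , d∈q , d⊑x) = find aq
  in lose (∈-*ₚ⁺ c∈p d∈q) (⊑-+ᵥ⁺ c⊑x d⊑x)

Mentions-*ₚˡ : ∀ {n} {i} {p q : Poly n} → NonEmpty q → Mentions i p → Mentions i (p *ₚ q)
Mentions-*ₚˡ {i = i} (d , d∈q) v =
  let (c , c∈p , h) = find v in lose (∈-*ₚ⁺ c∈p d∈q) (ℕₚ.≤-trans h (ℕₚ.m≤m+n (c i) (d i)))

Mentions-*ₚʳ : ∀ {n} {i} {p q : Poly n} → NonEmpty p → Mentions i q → Mentions i (p *ₚ q)
Mentions-*ₚʳ {i = i} (c , c∈p) v =
  let (d , d∈q , h) = find v in lose (∈-*ₚ⁺ c∈p d∈q) (ℕₚ.≤-trans h (ℕₚ.m≤n+m (d i) (c i)))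

ZeroOne-*ₚˡ : ∀ {n} {p q : Poly n} → NonEmpty q → ZeroOne (p *ₚ q) → ZeroOne p
ZeroOne-*ₚˡ (d , d∈q) zo = All.tabulate λ {c} c∈p i →
  ℕₚ.≤-trans (ℕₚ.m≤m+n (c i) (d i)) (All.lookup zo (∈-*ₚ⁺ c∈p d∈q) i)

ZeroOne-*ₚʳ : ∀ {n} {p q : Poly n} → NonEmpty p → ZeroOne (p *ₚ q) → ZeroOne q
ZeroOne-*ₚʳ (c , c∈p) zo = All.tabulate λ {d} d∈q i →
  ℕₚ.≤-trans (ℕₚ.m≤n+m (d i) (c i)) (All.lookup zo (∈-*ₚ⁺ c∈p d∈q) i)

Share⇒¬ZeroOne-*ₚ : ∀ {n} {p q : Poly n} → Share p q → ¬ ZeroOne (p *ₚ q)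
Share⇒¬ZeroOne-*ₚ (i , vp , vq) zo =
  let (c , c∈p , hc) = find vp ; (d , d∈q , hd) = find vq
  in ℕₚ.<-irrefl refl (ℕₚ.≤-trans (ℕₚ.+-mono-≤ hc hd) (All.lookup zo (∈-*ₚ⁺ c∈p d∈q) i))

-- The polynomial p of an arithmetic node determines the function g of the
-- corresponding monotone node only when all monomials of p are 0/1 vectors.
record Approximates {n} (p : Poly n) (g : BoolFun n) : Set where
  field
    nonEmpty : NonEmpty p
    mentions : ∀ i → DependsOn g i → Mentions i p
    sound    : ZeroOne p → ∀ x → g x ≡ true → Any (_⊑ x) p
    complete : ZeroOne p → ∀ x → Any (_⊑ x) p → g x ≡ true
open Approximates

Approximates-input : ∀ {n} (i : Fin n) → Approximates (arLit i) (monLit i)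
Approximates-input i = record
  { nonEmpty = unitVec i , here refl
  ; mentions = mentions-i
  ; sound    = λ _ x xi → here λ j le → subst (λ j → x j ≡ true) (only-i le) xi
  ; complete = λ { _ x (here h) → h i (ℕₚ.≤-reflexive (sym (unitVec-same i))) }
  }
  where
  only-i : ∀ {j} → 1 ≤ unitVec i j → i ≡ j
  only-i {j} le with i ≟ j
  ... | yes i≡j = i≡j
  ... | no i≢j  = contradiction (unitVec-other (i≢j ∘ sym)) (ℕₚ.<⇒≢ le ∘ sym)
  mentions-i : ∀ j → DependsOn (monLit i) j → Mentions j (arLit i)
  mentions-i j (x , ne) with j ≟ i
  ... | yes refl = here (ℕₚ.≤-reflexive (sym (unitVec-same j)))
  ... | no j≢i   = contradiction (sym (flipAt-other x (j≢i ∘ sym))) ne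

Approximates-+ : ∀ {n} {p q : Poly n} {g h} → Approximates p g → Approximates q h →
  Approximates (p ++ q) (boolOp OR g h)
Approximates-+ {p = p} {q} {g} {h} A B = record
  { nonEmpty = proj₁ (nonEmpty A) , Anyₚ.++⁺ˡ (proj₂ (nonEmpty A))
  ; mentions = λ i d → [ Anyₚ.++⁺ˡ ∘ mentions A i , Anyₚ.++⁺ʳ p ∘ mentions B i ]′ (DependsOn-boolOp OR g h d)
  ; sound    = λ zo x e → [ Anyₚ.++⁺ˡ ∘ sound A (zo₁ zo) x , Anyₚ.++⁺ʳ p ∘ sound B (zo₂ zo) x ]′ (or-true⁻ g h x e)
  ; complete = λ zo x a → or-true⁺ g h x
      ([ inj₁ ∘ complete A (zo₁ zo) x , inj₂ ∘ complete B (zo₂ zo) x ]′ (Anyₚ.++⁻ p a))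
  }
  where
  zo₁ : ZeroOne (p ++ q) → ZeroOne p
  zo₁ = Allₚ.++⁻ˡ p
  zo₂ : ZeroOne (p ++ q) → ZeroOne q
  zo₂ = Allₚ.++⁻ʳ p

Approximates-*ₚ-mentions : ∀ {n} o {p q : Poly n} {g h} → Approximates p g → Approximates q h →
  ∀ i → DependsOn (boolOp o g h) i → Mentions i (p *ₚ q)
Approximates-*ₚ-mentions o {g = g} {h} A B i d =
  [ Mentions-*ₚˡ (nonEmpty B) ∘ mentions A i , Mentions-*ₚʳ (nonEmpty A) ∘ mentions B i ]′ (DependsOn-boolOp o g h d)

-- When the factors share a variable no 0/1 monomial arises, so any gate will do.
Approximates-*-shared : ∀ {n} {p q : Poly n} {g h} → Share p q → Approximates p g → Approximates q h →
  Approximates (p *ₚ q) (boolOp OR g h)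
Approximates-*-shared sh A B = record
  { nonEmpty = NonEmpty-*ₚ (nonEmpty A) (nonEmpty B)
  ; mentions = Approximates-*ₚ-mentions OR A B
  ; sound    = λ zo → contradiction zo (Share⇒¬ZeroOne-*ₚ sh)
  ; complete = λ zo → contradiction zo (Share⇒¬ZeroOne-*ₚ sh)
  }

Approximates-* : ∀ {n} {p q : Poly n} {g h} → Approximates p g → Approximates q h →
  Approximates (p *ₚ q) (boolOp AND g h)
Approximates-* {p = p} {q} {g} {h} A B = record
  { nonEmpty = NonEmpty-*ₚ (nonEmpty A) (nonEmpty B)
  ; mentions = Approximates-*ₚ-mentions AND A B
  ; sound    = λ zo x e → let (e₁ , e₂) = and-true⁻ g h x e in
      Any⊑-*ₚ⁺ p q (sound A (zo₁ zo) x e₁) (sound B (zo₂ zo) x e₂)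
  ; complete = λ zo x a → let (a₁ , a₂) = Any⊑-*ₚ⁻ p q a in
      and-true⁺ g h x (complete A (zo₁ zo) x a₁) (complete B (zo₂ zo) x a₂)
  }
  where
  zo₁ : ZeroOne (p *ₚ q) → ZeroOne p
  zo₁ = ZeroOne-*ₚˡ (nonEmpty B)
  zo₂ : ZeroOne (p *ₚ q) → ZeroOne q
  zo₂ = ZeroOne-*ₚʳ (nonEmpty A)

module ArithToMon {n : ℕ} where

  step : ∀ {k} → AOp → Poly n → Poly n → Ref (Fin n) k → Ref (Fin n) k →
    Ref (Fin n) k ⊎ (BOp × Ref (Fin n) k × Ref (Fin n) k)
  step PLUS  p q r₁ r₂ = inj₂ (OR , r₁ , r₂)
  step TIMES p q r₁ r₂ with Share? p q
  ... | yes _ = inj₂ (OR , r₁ , r₂)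
  ... | no _  = inj₂ (AND , r₁ , r₂)

  open Translation arLit arOp monLit boolOp (Ref (Fin n)) weakenRef (inj₂ zero) inj₁ step

  ApproximatedBy : Poly n → ∀ {k} → Gates (Fin n) BOp k → Ref (Fin n) k → Set
  ApproximatedBy p c r = Approximates p (eval monLit boolOp c r)

  open Sound ApproximatedBy (λ _ _ _ → ⊤) multCond
    (λ {p} {_} {c} {g} {r} → subst (Approximates p) (sym (eval-weakenRef monLit boolOp c g r)))
    (λ i _ → Approximates-input i)

  step-sound : StepSound
  step-sound PLUS  p q c r₁ r₂ A B _ = Approximates-+ A B , tt
  step-sound TIMES p q c r₁ r₂ A B _ with Share? p q
  ... | yes sh = Approximates-*-shared sh A B , tt
  ... | no ¬sh = Approximates-* A B , λ i (d₁ , d₂) → ¬sh (i , mentions A i d₁ , mentions B i d₂)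

  arith⇒multilinearMon : ∀ {f : BoolFun n} → Monotone f → ArithCircuits (LowN f) ≼ MultilinearMonCircuits f
  arith⇒multilinearMon {f} mf (circuit gs o , produces) =
    size , size≤ , circuit gs′ (node o) , computes , proj₁ simulates
    where
    open Translated (translate gs) renaming (gs to gs′)
    simulates = translate-sound step-sound gs (EveryGate-⊤ arLit arOp gs)
    A = proj₂ simulates o
    p = poly (circuit gs o)
    low : ∀ {m} → m ∈ p → LowN f m
    low m∈p = proj₂ (produces _) (∈⇒Occurs m∈p)
    zeroOne : ZeroOne p
    zeroOne = All.tabulate λ m∈p i → let (b , _ , e) = low m∈p in subst (_≤ 1) (sym (e i)) (b2n≤1 (b i))
    computes : ∀ x → eval monLit boolOp gs′ (node o) x ≡ f x
    computes x = bool-ext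
      (λ gx → let (m , m∈p , m⊑x) = find (sound A zeroOne x gx) ; (b , lb , e) = low m∈p in
         Low-upward mf lb (≤ᵥ-from-true λ i bi → m⊑x i (subst (1 ≤_) (sym (e i)) (ℕₚ.≤-reflexive (cong b2n (sym bi))))))
      (λ fx → let (a , a≤x , la) = Low-below (monotone⇒congruent mf) x fx in
         complete A zeroOne x (Any.map (λ e i le → ≤ᵇ-true (a≤x i) (1≤b2n⇒true (subst (1 ≤_) (e i) le)))
           (proj₁ (produces (toNVec a)) (a , la , λ _ → refl))))

open ArithToMon using (arith⇒multilinearMon)

-- Lin(f) ≤ mLin(f)

positive : ∀ {n} → Fin n → Literal n
positive i = i , true

positiveRef : ∀ {n k} → Ref (Fin n) k → Ref (Literal n) k
positiveRef (inj₁ i) = inj₁ (positive i)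
positiveRef (inj₂ j) = inj₂ j

positiveGates : ∀ {n k} → Gates (Fin n) BOp k → Gates (Literal n) BOp k
positiveGates [] = []
positiveGates (c ▷ gate o r₁ r₂) = positiveGates c ▷ gate o (positiveRef r₁) (positiveRef r₂)

eval-positiveGates : ∀ {n k} (c : Gates (Fin n) BOp k) r x →
  eval dmLit boolOp (positiveGates c) (positiveRef r) x ≡ eval monLit boolOp c r x
eval-positiveGates c (inj₁ i) x = refl
eval-positiveGates (c ▷ gate o r₁ r₂) (inj₂ zero) x =
  boolOp-cong o (eval-positiveGates c r₁ x) (eval-positiveGates c r₂ x)
eval-positiveGates (c ▷ gate _ _ _) (inj₂ (suc j)) x = eval-positiveGates c (inj₂ j) x

EveryGate-positiveGates : ∀ {n k} (c : Gates (Fin n) BOp k) → EveryGate monLit boolOp multCond c →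
  EveryGate dmLit boolOp multCond (positiveGates c)
EveryGate-positiveGates [] _ = tt
EveryGate-positiveGates (c ▷ gate o r₁ r₂) (ec , m) =
  EveryGate-positiveGates c ec ,
  multCond-cong o (sym ∘ eval-positiveGates c r₁) (sym ∘ eval-positiveGates c r₂) m

multilinearMon⇒multilinearDM : ∀ {n} {f : BoolFun n} → MultilinearMonCircuits f ≼ MultilinearDMCircuits f
multilinearMon⇒multilinearDM {s = s} (circuit gs o , computes , multilinear) =
  s , ℕₚ.≤-refl , circuit (positiveGates gs) (positiveRef o) ,
  (λ x → trans (eval-positiveGates gs o x) (computes x)) , EveryGate-positiveGates gs multilinear

-- mLin(f) ≤ Lin(f)

merge : ∀ {n} → BVec n → BVec n → BVec n → BVec n
merge s y₁ y₂ i = if s i then y₁ i else y₂ i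

merge-≤ : ∀ {n} (s : BVec n) {y₁ y₂ x} → y₁ ≤ᵥ x → y₂ ≤ᵥ x → merge s y₁ y₂ ≤ᵥ x
merge-≤ s le₁ le₂ i with s i
... | true  = le₁ i
... | false = le₂ i

merge-true : ∀ {n} {s : BVec n} {y₁ y₂ i} → s i ≡ true → merge s y₁ y₂ i ≡ y₁ i
merge-true e rewrite e = refl

merge-false : ∀ {n} {s : BVec n} {y₁ y₂ i} → s i ≡ false → merge s y₁ y₂ i ≡ y₂ i
merge-false e rewrite e = refl

clearAt : ∀ {n} → BVec n → Fin n → BVec n
clearAt y i j = if does (j ≟ i) then false else y j

clearAt-other : ∀ {n} (y : BVec n) {i j} → j ≢ i → clearAt y i j ≡ y j
clearAt-other y {i} {j} j≢i rewrite dec-false (j ≟ i) j≢i = refl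

clearAt-≤ : ∀ {n} {y x x' : BVec n} {i} → y ≤ᵥ x → (∀ j → j ≢ i → x j ≡ x' j) → clearAt y i ≤ᵥ x'
clearAt-≤ {y = y} {i = i} le agree j with j ≟ i
... | yes _  = Boolₚ.≤-minimum _
... | no j≢i = subst (y j ≤ᵇ_) (agree j j≢i) (le j)

record UpClosure {n} (g h : BoolFun n) : Set where
  field
    congruent : Congruent g
    down      : ∀ x → h x ≡ true → ∃[ y ] y ≤ᵥ x × g y ≡ true
    up        : ∀ {x y} → y ≤ᵥ x → g y ≡ true → h x ≡ true
open UpClosure

UpClosure-cong : ∀ {n} {g h h' : BoolFun n} → (∀ x → h x ≡ h' x) → UpClosure g h → UpClosure g h'
UpClosure-cong e U = record
  { congruent = congruent U
  ; down      = λ x hx → down U x (trans (e x) hx)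
  ; up        = λ le gy → trans (sym (e _)) (up U le gy)
  }

UpClosure-OR : ∀ {n} {g₁ g₂ h₁ h₂ : BoolFun n} → UpClosure g₁ h₁ → UpClosure g₂ h₂ →
  UpClosure (boolOp OR g₁ g₂) (boolOp OR h₁ h₂)
UpClosure-OR {g₁ = g₁} {g₂} {h₁} {h₂} U₁ U₂ = record
  { congruent = boolOp-congruent OR (congruent U₁) (congruent U₂)
  ; down      = λ x e → [ witness U₁ inj₁ x , witness U₂ inj₂ x ]′ (or-true⁻ h₁ h₂ x e)
  ; up        = λ le gy → or-true⁺ h₁ h₂ _ ([ inj₁ ∘ up U₁ le , inj₂ ∘ up U₂ le ]′ (or-true⁻ g₁ g₂ _ gy))
  }
  where
  witness : ∀ {g h} → UpClosure g h → (∀ {y} → g y ≡ true → g₁ y ≡ true ⊎ g₂ y ≡ true) →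
    ∀ x → h x ≡ true → ∃[ y ] y ≤ᵥ x × boolOp OR g₁ g₂ y ≡ true
  witness U side x hx = let (y , le , gy) = down U x hx in y , le , or-true⁺ g₁ g₂ y (side gy)

-- Below x, g₁ and g₂ are witnessed separately; independence lets the two
-- witnesses be merged into one.
UpClosure-AND : ∀ {n} {g₁ g₂ h₁ h₂ : BoolFun n} → Independent g₁ g₂ → UpClosure g₁ h₁ → UpClosure g₂ h₂ →
  UpClosure (boolOp AND g₁ g₂) (boolOp AND h₁ h₂)
UpClosure-AND {g₁ = g₁} {g₂} {h₁} {h₂} ind U₁ U₂ = record
  { congruent = boolOp-congruent AND (congruent U₁) (congruent U₂)
  ; down      = down-AND
  ; up        = λ le gy → let (e₁ , e₂) = and-true⁻ g₁ g₂ _ gy in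
                  and-true⁺ h₁ h₂ _ (up U₁ le e₁) (up U₂ le e₂)
  }
  where
  s : BVec _
  s i = does (DependsOn? (congruent U₁) i)
  s-true : ∀ {i} → DependsOn g₁ i → s i ≡ true
  s-true {i} d = dec-true (DependsOn? (congruent U₁) i) d
  s-false : ∀ {i} → DependsOn g₂ i → s i ≡ false
  s-false {i} d = dec-false (DependsOn? (congruent U₁) i) λ d₁ → ind i (d₁ , d)
  down-AND : ∀ x → boolOp AND h₁ h₂ x ≡ true → ∃[ y ] y ≤ᵥ x × boolOp AND g₁ g₂ y ≡ true
  down-AND x e =
    let (e₁ , e₂) = and-true⁻ h₁ h₂ x e ; (y₁ , le₁ , gy₁) = down U₁ x e₁ ; (y₂ , le₂ , gy₂) = down U₂ x e₂
    in merge s y₁ y₂ , merge-≤ s le₁ le₂ ,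
       and-true⁺ g₁ g₂ _
         (trans (congruent-on-dependencies (congruent U₁) λ i d → merge-true {s = s} {y₁} {y₂} (s-true d)) gy₁)
         (trans (congruent-on-dependencies (congruent U₂) λ i d → merge-false {s = s} {y₁} {y₂} (s-false d)) gy₂)

UpClosure-boolOp : ∀ {n} o {g₁ g₂ h₁ h₂ : BoolFun n} → multCond o g₁ g₂ → UpClosure g₁ h₁ → UpClosure g₂ h₂ →
  UpClosure (boolOp o g₁ g₂) (boolOp o h₁ h₂)
UpClosure-boolOp OR  _   = UpClosure-OR
UpClosure-boolOp AND ind = UpClosure-AND ind

-- If h depended on i while g did not, clearing position i of a witness below x
-- would give a witness below x with position i flipped.
UpClosure-DependsOn : ∀ {n} {g h : BoolFun n} → UpClosure g h → ∀ {i} → DependsOn h i → DependsOn g i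
UpClosure-DependsOn {g = g} {h} U {i} (x , ne) with DependsOn? (congruent U) i
... | yes d = d
... | no nd = contradiction (bool-ext (transfer (λ j j≢i → sym (flipAt-other x j≢i)))
                                      (transfer (λ j j≢i → flipAt-other x j≢i))) ne
  where
  transfer : ∀ {x x'} → (∀ j → j ≢ i → x j ≡ x' j) → h x ≡ true → h x' ≡ true
  transfer {x} agree hx =
    let (y , le , gy) = down U x hx
        cleared = congruent-on-dependencies (congruent U) λ j d → clearAt-other y λ { refl → nd d }
    in up U (clearAt-≤ le agree) (trans cleared gy)

UpClosure-DependsOn-Independent : ∀ {n} {g₁ g₂ h₁ h₂ : BoolFun n} → UpClosure g₁ h₁ → UpClosure g₂ h₂ →
  Independent g₁ g₂ → Independent h₁ h₂
UpClosure-DependsOn-Independent U₁ U₂ ind i (d₁ , d₂) = ind i (UpClosure-DependsOn U₁ d₁ , UpClosure-DependsOn U₂ d₂)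

module DMToMon {n : ℕ} where

  -- nothing stands for the constant true function, the closure of a negative literal.
  Node : ℕ → Set
  Node k = Maybe (Ref (Fin n) k)

  nodeFun : ∀ {k} → Gates (Fin n) BOp k → Node k → BoolFun n
  nodeFun c nothing  = λ _ → true
  nodeFun c (just r) = eval monLit boolOp c r

  input : ∀ {k} → Literal n → Node k
  input (i , true)  = just (inj₁ i)
  input (i , false) = nothing

  step : ∀ {k} → BOp → BoolFun n → BoolFun n → Node k → Node k → Node k ⊎ (BOp × Ref (Fin n) k × Ref (Fin n) k)
  step OR  _ _ nothing   _         = inj₁ nothing
  step OR  _ _ (just _)  nothing   = inj₁ nothing
  step AND _ _ nothing   v₂        = inj₁ v₂
  step AND _ _ (just r₁) nothing   = inj₁ (just r₁)
  step o   _ _ (just r₁) (just r₂) = inj₂ (o , r₁ , r₂)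

  open Translation dmLit boolOp monLit boolOp Node (Maybe.map weakenRef) (just (inj₂ zero)) input step

  ClosedBy : BoolFun n → ∀ {k} → Gates (Fin n) BOp k → Node k → Set
  ClosedBy g c v = UpClosure g (nodeFun c v)

  nodeFun-weaken : ∀ {k} (c : Gates (Fin n) BOp k) g v x → nodeFun c v x ≡ nodeFun (c ▷ g) (Maybe.map weakenRef v) x
  nodeFun-weaken c g nothing  x = refl
  nodeFun-weaken c g (just r) x = cong (λ h → h x) (sym (eval-weakenRef monLit boolOp c g r))

  UpClosure-input : ∀ l {k} (c : Gates (Fin n) BOp k) → ClosedBy (dmLit l) c (input l)
  UpClosure-input (i , true) c = record
    { congruent = dmLit-congruent (i , true)
    ; down      = λ x xi → x , ≤ᵥ-refl , xi
    ; up        = λ le yi → ≤ᵇ-true (le i) yi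
    }
  UpClosure-input (i , false) c = record
    { congruent = dmLit-congruent (i , false)
    ; down      = λ x _ → allFalse , allFalse-≤ x , refl
    ; up        = λ _ _ → refl
    }

  open Sound ClosedBy multCond multCond
    (λ {g} {_} {c} {gt} {v} → UpClosure-cong (nodeFun-weaken c gt v)) UpClosure-input

  step-sound : StepSound
  step-sound OR  g₁ g₂ c nothing   v₂        U₁ U₂ m = UpClosure-OR U₁ U₂
  step-sound OR  g₁ g₂ c (just r₁) nothing   U₁ U₂ m = UpClosure-cong true-right (UpClosure-OR U₁ U₂)
    where
    true-right : ∀ x → boolOp OR (eval monLit boolOp c r₁) (λ _ → true) x ≡ true
    true-right x with eval monLit boolOp c r₁ x
    ... | true  = refl
    ... | false = refl
  step-sound AND g₁ g₂ c nothing   v₂        U₁ U₂ m = UpClosure-AND m U₁ U₂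
  step-sound AND g₁ g₂ c (just r₁) nothing   U₁ U₂ m = UpClosure-cong true-right (UpClosure-AND m U₁ U₂)
    where
    true-right : ∀ x → boolOp AND (eval monLit boolOp c r₁) (λ _ → true) x ≡ eval monLit boolOp c r₁ x
    true-right x with eval monLit boolOp c r₁ x
    ... | true  = refl
    ... | false = refl
  step-sound OR  g₁ g₂ c (just r₁) (just r₂) U₁ U₂ m = UpClosure-OR U₁ U₂ , tt
  step-sound AND g₁ g₂ c (just r₁) (just r₂) U₁ U₂ m = UpClosure-AND m U₁ U₂ , UpClosure-DependsOn-Independent U₁ U₂ m

  -- Since f is monotone it is its own upward closure; the closure is not
  -- constant because f is not.
  multilinearDM⇒multilinearMon : ∀ {f : BoolFun n} → Monotone f → NonConstant f →
    MultilinearDMCircuits f ≼ MultilinearMonCircuits f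
  multilinearDM⇒multilinearMon {f} mf (x₀ , y₀ , f≢) (circuit gs o , computes , multilinear) =
    output (node o) (proj₂ simulates o)
    where
    open Translated (translate gs) renaming (gs to gs′)
    simulates = translate-sound step-sound gs multilinear
    witness⇒true : ∀ {x y} → y ≤ᵥ x → dmFun (circuit gs o) y ≡ true → f x ≡ true
    witness⇒true y≤x gy = ≤ᵇ-true (mf _ _ y≤x) (trans (sym (computes _)) gy)
    output : (v : Node size) → ClosedBy (dmFun (circuit gs o)) gs′ v → ∃[ k ] k ≤ _ × MultilinearMonCircuits f k
    output nothing  U = contradiction (trans (everywhere x₀) (sym (everywhere y₀))) f≢
      where
      everywhere : ∀ x → f x ≡ true
      everywhere x = let (y , y≤x , gy) = down U x refl in witness⇒true y≤x gy
    output (just r) U = size , size≤ , circuit gs′ r , computes′ , proj₁ simulates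
      where
      computes′ : ∀ x → eval monLit boolOp gs′ r x ≡ f x
      computes′ x = bool-ext (λ e → let (y , y≤x , gy) = down U x e in witness⇒true y≤x gy)
                             (λ fx → up U ≤ᵥ-refl (trans (computes x) fx))

open DMToMon using (multilinearDM⇒multilinearMon)

-- Read₁(f) ≤ mLin(f)

Low-input : ∀ {n} (i : Fin n) {a} → Low (monLit i) a → toNVec a ≗ᵥ unitVec i
Low-input i {a} (ai , minimal) j with j ≟ i
... | yes refl rewrite ai = refl
... | no j≢i with a j in aj
...   | false = refl
...   | true  = contradiction
        (trans (sym (flipAt-other a (j≢i ∘ sym))) (minimal (flipAt a j) (flipAt-true-≤ a j aj) (flipAt-≢ a j)))
        (λ e → true≢false (trans (sym ai) e))

Low-OR : ∀ {n} (g h : BoolFun n) {a} → Low (boolOp OR g h) a → Low g a ⊎ Low h a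
Low-OR g h {a} (fa , minimal) with or-true⁻ g h a fa
... | inj₁ ga = inj₁ (ga , λ b le ne → proj₁ (or-false⁻ g h b (minimal b le ne)))
... | inj₂ ha = inj₂ (ha , λ b le ne → proj₂ (or-false⁻ g h b (minimal b le ne)))

-- Split a into its parts on the variables of g and of h; the minimal true
-- points of g and h below these parts together form a true point below a,
-- which by minimality is a itself.
Low-AND : ∀ {n} {g h : BoolFun n} → Monotone g → Monotone h → Independent g h →
  ∀ {a} → Low (boolOp AND g h) a → ∃[ b₁ ] ∃[ b₂ ] Low g b₁ × Low h b₂ × toNVec a ≗ᵥ (toNVec b₁ +ᵥ toNVec b₂)
Low-AND {n} {g} {h} mg mh ind {a} (fa , minimal) = b₁ , b₂ , lb₁ , lb₂ , split
  where
  cg = monotone⇒congruent mg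
  ch = monotone⇒congruent mh
  s : BVec n
  s i = does (DependsOn? cg i)
  s-true : ∀ {i} → DependsOn g i → s i ≡ true
  s-true {i} d = dec-true (DependsOn? cg i) d
  s-false : ∀ {i} → DependsOn h i → s i ≡ false
  s-false {i} d = dec-false (DependsOn? cg i) λ d′ → ind i (d′ , d)
  a₁ = merge s a allFalse
  a₂ = merge s allFalse a
  ga₁ : g a₁ ≡ true
  ga₁ = trans (congruent-on-dependencies cg λ i d → merge-true {s = s} {a} {allFalse} (s-true d))
              (proj₁ (and-true⁻ g h a fa))
  ha₂ : h a₂ ≡ true
  ha₂ = trans (congruent-on-dependencies ch λ i d → merge-false {s = s} {allFalse} {a} (s-false d))
              (proj₂ (and-true⁻ g h a fa))
  B₁ = Low-below cg a₁ ga₁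
  B₂ = Low-below ch a₂ ha₂
  b₁ = proj₁ B₁
  b₂ = proj₁ B₂
  lb₁ = proj₂ (proj₂ B₁)
  lb₂ = proj₂ (proj₂ B₂)
  b₁-off : ∀ {i} → s i ≡ false → b₁ i ≡ false
  b₁-off {i} e = ≤ᵇ-false (subst (b₁ i ≤ᵇ_) (merge-false {s = s} {a} {allFalse} e) (proj₁ (proj₂ B₁) i))
  b₂-off : ∀ {i} → s i ≡ true → b₂ i ≡ false
  b₂-off {i} e = ≤ᵇ-false (subst (b₂ i ≤ᵇ_) (merge-true {s = s} {allFalse} {a} e) (proj₁ (proj₂ B₂) i))
  b = merge s b₁ b₂
  b≤a : b ≤ᵥ a
  b≤a = merge-≤ s (≤ᵥ-trans (proj₁ (proj₂ B₁)) (merge-≤ s ≤ᵥ-refl (allFalse-≤ a)))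
                  (≤ᵥ-trans (proj₁ (proj₂ B₂)) (merge-≤ s (allFalse-≤ a) ≤ᵥ-refl))
  fb : boolOp AND g h b ≡ true
  fb = and-true⁺ g h b
    (trans (congruent-on-dependencies cg λ i d → merge-true {s = s} {b₁} {b₂} (s-true d)) (proj₁ lb₁))
    (trans (congruent-on-dependencies ch λ i d → merge-false {s = s} {b₁} {b₂} (s-false d)) (proj₁ lb₂))
  b≗a : b ≗ᵥ a
  b≗a = decidable-stable (b ≗ᵥ? a) λ ne → true≢false (trans (sym fb) (minimal b b≤a ne))
  split : toNVec a ≗ᵥ (toNVec b₁ +ᵥ toNVec b₂)
  split i with s i in si
  ... | true  rewrite sym (b≗a i) | merge-true {s = s} {b₁} {b₂} si | b₂-off si = sym (ℕₚ.+-identityʳ _)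
  ... | false rewrite sym (b≗a i) | merge-false {s = s} {b₁} {b₂} si | b₁-off si = refl

read-one : ∀ {n k} (c : Gates (Fin n) BOp k) → EveryGate monLit boolOp multCond c →
  ∀ r {a} → Low (eval monLit boolOp c r) a → eval BLit BOpSet c r (toNVec a)
read-one c ml (inj₁ i) la = Low-input i la
read-one (c ▷ gate OR r₁ r₂) (ml , _) (inj₂ zero) la =
  [ inj₁ ∘ read-one c ml r₁ , inj₂ ∘ read-one c ml r₂ ]′ (Low-OR _ _ la)
read-one (c ▷ gate AND r₁ r₂) (ml , ind) (inj₂ zero) la =
  let (b₁ , b₂ , l₁ , l₂ , split) = Low-AND (eval-monotone c r₁) (eval-monotone c r₂) ind la
  in toNVec b₁ , toNVec b₂ , read-one c ml r₁ l₁ , read-one c ml r₂ l₂ , split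
read-one (c ▷ gate _ _ _) (ml , _) (inj₂ (suc j)) = read-one c ml (inj₂ j)

multilinearMon⇒readOne : ∀ {n} {f : BoolFun n} → MultilinearMonCircuits f ≼ ReadOneCircuits f
multilinearMon⇒readOne {s = s} (circuit gs o , computes , multilinear) =
  s , ℕₚ.≤-refl , circuit gs o , computes , λ a la → read-one gs multilinear o (Low-computes computes la)

-- Arith(Env(Low(f))) ≤ Read₁(f)

LeastDegree : ∀ {n} → ℕ → Poly n → Set
LeastDegree v p = (∃[ m ] m ∈ p × degree m ≡ v) × (∀ {m} → m ∈ p → v ≤ degree m)

lowDegree : ∀ {n} → Poly n → ℕ
lowDegree []       = 0
lowDegree (m ∷ ms) = degree (argmin degree m ms)

lowDegree-least : ∀ {n} {p : Poly n} → NonEmpty p → LeastDegree (lowDegree p) p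
lowDegree-least {p = m ∷ ms} _ = (argmin degree m ms , attained , refl) , bound
  where
  attained : argmin degree m ms ∈ m ∷ ms
  attained = [ (λ e → here e) , there ]′ (argmin-sel degree m ms)
  bound : ∀ {m′} → m′ ∈ m ∷ ms → degree (argmin degree m ms) ≤ degree m′
  bound (here refl) = f[argmin]≤f[⊤] {f = degree} m ms
  bound (there m′∈) = All.lookup (f[argmin]≤f[xs] {f = degree} m ms) m′∈

LeastDegree-unique : ∀ {n} {v w} {p : Poly n} → LeastDegree v p → LeastDegree w p → v ≡ w
LeastDegree-unique ((m , m∈ , dm) , v≤) ((m′ , m′∈ , dm′) , w≤) =
  ℕₚ.≤-antisym (subst (_ ≤_) dm′ (v≤ m′∈)) (subst (_ ≤_) dm (w≤ m∈))

LeastDegree-Occurs : ∀ {n} {v} {a : NVec n} {p} → LeastDegree v p → Occurs a p → v ≤ degree a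
LeastDegree-Occurs (_ , v≤) o = let (m , m∈ , e) = find o in subst (_ ≤_) (degree-cong e) (v≤ m∈)

LeastDegree-++ˡ : ∀ {n} {v w} {p q : Poly n} → LeastDegree v p → LeastDegree w q → v ≤ w → LeastDegree v (p ++ q)
LeastDegree-++ˡ {p = p} ((m , m∈ , dm) , v≤) (_ , w≤) v≤w =
  (m , Anyₚ.++⁺ˡ m∈ , dm) , λ m′∈ → [ v≤ , ℕₚ.≤-trans v≤w ∘ w≤ ]′ (Anyₚ.++⁻ p m′∈)

LeastDegree-++ʳ : ∀ {n} {v w} {p q : Poly n} → LeastDegree v p → LeastDegree w q → w ≤ v → LeastDegree w (p ++ q)
LeastDegree-++ʳ {p = p} (_ , v≤) ((m , m∈ , dm) , w≤) w≤v =
  (m , Anyₚ.++⁺ʳ p m∈ , dm) , λ m′∈ → [ ℕₚ.≤-trans w≤v ∘ v≤ , w≤ ]′ (Anyₚ.++⁻ p m′∈)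

LeastDegree-*ₚ : ∀ {n} {v w} {p q : Poly n} → LeastDegree v p → LeastDegree w q → LeastDegree (v + w) (p *ₚ q)
LeastDegree-*ₚ {p = p} {q} ((m , m∈ , dm) , v≤) ((m′ , m′∈ , dm′) , w≤) =
  (m +ᵥ m′ , ∈-*ₚ⁺ m∈ m′∈ , trans (degree-+ᵥ m m′) (cong₂ _+_ dm dm′)) , bound
  where
  bound : ∀ {x} → x ∈ p *ₚ q → _ ≤ degree x
  bound x∈ with ∈-*ₚ⁻ p q x∈
  ... | c , d , c∈ , d∈ , refl = subst (_ ≤_) (sym (degree-+ᵥ c d)) (ℕₚ.+-mono-≤ (v≤ c∈) (w≤ d∈))

record LowestPart {n} (p q : Poly n) : Set where
  field
    nonEmpty : NonEmpty p
    sound    : ∀ {m} → Occurs m q → Occurs m p × degree m ≡ lowDegree p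
    complete : ∀ {m} → Occurs m p → degree m ≡ lowDegree p → Occurs m q
open LowestPart

LowestPart-least : ∀ {n} {p q : Poly n} → LowestPart p q → LeastDegree (lowDegree p) p
LowestPart-least L = lowDegree-least (nonEmpty L)

LowestPart-input : ∀ {n} (i : Fin n) → LowestPart (arLit i) (arLit i)
LowestPart-input i = record
  { nonEmpty = unitVec i , here refl
  ; sound    = λ { o@(here e) → o , degree-cong (≗ᵥ-sym e) }
  ; complete = λ o _ → o
  }

LowestPart-++ˡ : ∀ {n} {p₁ p₂ q₁ q₂ : Poly n} → LowestPart p₁ q₁ → LowestPart p₂ q₂ →
  lowDegree p₁ < lowDegree p₂ → LowestPart (p₁ ++ p₂) q₁
LowestPart-++ˡ {p₁ = p₁} {p₂} L₁ L₂ lt = record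
  { nonEmpty = proj₁ (nonEmpty L₁) , Anyₚ.++⁺ˡ (proj₂ (nonEmpty L₁))
  ; sound    = λ o → let (o₁ , d) = sound L₁ o in Anyₚ.++⁺ˡ o₁ , trans d (sym low)
  ; complete = λ o d → [ (λ o₁ → complete L₁ o₁ (trans d low))
                       , (λ o₂ → contradiction (ℕₚ.<-≤-trans lt (LeastDegree-Occurs (LowestPart-least L₂) o₂))
                                               (ℕₚ.<-irrefl (sym (trans d low)))) ]′ (Anyₚ.++⁻ p₁ o)
  }
  where
  low : lowDegree (p₁ ++ p₂) ≡ lowDegree p₁
  low = LeastDegree-unique (lowDegree-least (_ , Anyₚ.++⁺ˡ (proj₂ (nonEmpty L₁))))
          (LeastDegree-++ˡ (LowestPart-least L₁) (LowestPart-least L₂) (ℕₚ.<⇒≤ lt))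

LowestPart-++ʳ : ∀ {n} {p₁ p₂ q₁ q₂ : Poly n} → LowestPart p₁ q₁ → LowestPart p₂ q₂ →
  lowDegree p₂ < lowDegree p₁ → LowestPart (p₁ ++ p₂) q₂
LowestPart-++ʳ {p₁ = p₁} {p₂} L₁ L₂ lt = record
  { nonEmpty = proj₁ (nonEmpty L₁) , Anyₚ.++⁺ˡ (proj₂ (nonEmpty L₁))
  ; sound    = λ o → let (o₂ , d) = sound L₂ o in Anyₚ.++⁺ʳ p₁ o₂ , trans d (sym low)
  ; complete = λ o d → [ (λ o₁ → contradiction (ℕₚ.<-≤-trans lt (LeastDegree-Occurs (LowestPart-least L₁) o₁))
                                               (ℕₚ.<-irrefl (sym (trans d low))))
                       , (λ o₂ → complete L₂ o₂ (trans d low)) ]′ (Anyₚ.++⁻ p₁ o)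
  }
  where
  low : lowDegree (p₁ ++ p₂) ≡ lowDegree p₂
  low = LeastDegree-unique (lowDegree-least (_ , Anyₚ.++⁺ˡ (proj₂ (nonEmpty L₁))))
          (LeastDegree-++ʳ (LowestPart-least L₁) (LowestPart-least L₂) (ℕₚ.<⇒≤ lt))

LowestPart-++ : ∀ {n} {p₁ p₂ q₁ q₂ : Poly n} → LowestPart p₁ q₁ → LowestPart p₂ q₂ →
  lowDegree p₁ ≡ lowDegree p₂ → LowestPart (p₁ ++ p₂) (q₁ ++ q₂)
LowestPart-++ {p₁ = p₁} {p₂} {q₁} L₁ L₂ eq = record
  { nonEmpty = proj₁ (nonEmpty L₁) , Anyₚ.++⁺ˡ (proj₂ (nonEmpty L₁))
  ; sound    = λ o → [ (λ o₁ → let (o₁′ , d) = sound L₁ o₁ in Anyₚ.++⁺ˡ o₁′ , trans d (sym low))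
                     , (λ o₂ → let (o₂′ , d) = sound L₂ o₂ in Anyₚ.++⁺ʳ p₁ o₂′ , trans d (trans (sym eq) (sym low)))
                     ]′ (Anyₚ.++⁻ q₁ o)
  ; complete = λ o d → [ (λ o₁ → Anyₚ.++⁺ˡ (complete L₁ o₁ (trans d low)))
                       , (λ o₂ → Anyₚ.++⁺ʳ q₁ (complete L₂ o₂ (trans d (trans low eq)))) ]′ (Anyₚ.++⁻ p₁ o)
  }
  where
  low : lowDegree (p₁ ++ p₂) ≡ lowDegree p₁
  low = LeastDegree-unique (lowDegree-least (_ , Anyₚ.++⁺ˡ (proj₂ (nonEmpty L₁))))
          (LeastDegree-++ˡ (LowestPart-least L₁) (LowestPart-least L₂) (ℕₚ.≤-reflexive eq))

-- A product has least degree exactly when both factors do.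
LowestPart-*ₚ : ∀ {n} {p₁ p₂ q₁ q₂ : Poly n} → LowestPart p₁ q₁ → LowestPart p₂ q₂ → LowestPart (p₁ *ₚ p₂) (q₁ *ₚ q₂)
LowestPart-*ₚ {p₁ = p₁} {p₂} {q₁} {q₂} L₁ L₂ = record
  { nonEmpty = NonEmpty-*ₚ (nonEmpty L₁) (nonEmpty L₂)
  ; sound    = sound-*
  ; complete = complete-*
  }
  where
  low : lowDegree (p₁ *ₚ p₂) ≡ lowDegree p₁ + lowDegree p₂
  low = LeastDegree-unique (lowDegree-least (NonEmpty-*ₚ (nonEmpty L₁) (nonEmpty L₂)))
          (LeastDegree-*ₚ (LowestPart-least L₁) (LowestPart-least L₂))
  sound-* : ∀ {m} → Occurs m (q₁ *ₚ q₂) → Occurs m (p₁ *ₚ p₂) × degree m ≡ lowDegree (p₁ *ₚ p₂)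
  sound-* o with Occurs-*ₚ⁻ q₁ q₂ o
  ... | c , d , c∈ , d∈ , e with sound L₁ (∈⇒Occurs c∈) | sound L₂ (∈⇒Occurs d∈)
  ...   | (oc , dc) | (od , dd) =
    Occurs-*ₚ⁺ p₁ p₂ oc od e , trans (sym (degree-cong e)) (trans (degree-+ᵥ c d) (trans (cong₂ _+_ dc dd) (sym low)))
  complete-* : ∀ {m} → Occurs m (p₁ *ₚ p₂) → degree m ≡ lowDegree (p₁ *ₚ p₂) → Occurs m (q₁ *ₚ q₂)
  complete-* o dm with Occurs-*ₚ⁻ p₁ p₂ o
  ... | c , d , c∈ , d∈ , e =
    Occurs-*ₚ⁺ q₁ q₂ (complete L₁ (∈⇒Occurs c∈) (sym (proj₁ split))) (complete L₂ (∈⇒Occurs d∈) (sym (proj₂ split))) e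
    where
    split : lowDegree p₁ ≡ degree c × lowDegree p₂ ≡ degree d
    split = +-split-≡ (LeastDegree-Occurs (LowestPart-least L₁) (∈⇒Occurs c∈))
                      (LeastDegree-Occurs (LowestPart-least L₂) (∈⇒Occurs d∈))
                      (sym (trans (sym (degree-+ᵥ c d)) (trans (degree-cong e) (trans dm low))))

toAOp : BOp → AOp
toAOp OR  = PLUS
toAOp AND = TIMES

-- Its monomials form the exponent set B_F.
expPoly : ∀ {n k} → Gates (Fin n) BOp k → Ref (Fin n) k → Poly n
expPoly = eval arLit (arOp ∘ toAOp)

Bset⇒Occurs : ∀ {n k} (c : Gates (Fin n) BOp k) r {b} → eval BLit BOpSet c r b → Occurs b (expPoly c r)
Bset⇒Occurs c (inj₁ i) e = here (≗ᵥ-sym e)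
Bset⇒Occurs (c ▷ gate OR r₁ r₂) (inj₂ zero) (inj₁ x) = Anyₚ.++⁺ˡ (Bset⇒Occurs c r₁ x)
Bset⇒Occurs (c ▷ gate OR r₁ r₂) (inj₂ zero) (inj₂ x) = Anyₚ.++⁺ʳ _ (Bset⇒Occurs c r₂ x)
Bset⇒Occurs (c ▷ gate AND r₁ r₂) (inj₂ zero) (x , y , bx , by , e) =
  Occurs-*ₚ⁺ _ _ (Bset⇒Occurs c r₁ bx) (Bset⇒Occurs c r₂ by) (≗ᵥ-sym e)
Bset⇒Occurs (c ▷ gate _ _ _) (inj₂ (suc j)) = Bset⇒Occurs c (inj₂ j)

Occurs⇒Bset : ∀ {n k} (c : Gates (Fin n) BOp k) r {b} → Occurs b (expPoly c r) → eval BLit BOpSet c r b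
Occurs⇒Bset c (inj₁ i) (here e) = ≗ᵥ-sym e
Occurs⇒Bset (c ▷ gate OR r₁ r₂) (inj₂ zero) o =
  [ inj₁ ∘ Occurs⇒Bset c r₁ , inj₂ ∘ Occurs⇒Bset c r₂ ]′ (Anyₚ.++⁻ _ o)
Occurs⇒Bset (c ▷ gate AND r₁ r₂) (inj₂ zero) o =
  let (x , y , x∈ , y∈ , e) = Occurs-*ₚ⁻ _ _ o
  in x , y , Occurs⇒Bset c r₁ (∈⇒Occurs x∈) , Occurs⇒Bset c r₂ (∈⇒Occurs y∈) , ≗ᵥ-sym e
Occurs⇒Bset (c ▷ gate _ _ _) (inj₂ (suc j)) = Occurs⇒Bset c (inj₂ j)

isPos-+ : ∀ a b → isPos a ≤ᵇ isPos (a + b)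
isPos-+ zero    b = Boolₚ.≤-minimum _
isPos-+ (suc a) b = b≤b

support-+ᵥ : ∀ {n} {c d b : NVec n} → b ≗ᵥ (c +ᵥ d) → support c ≤ᵥ support b × support d ≤ᵥ support b
support-+ᵥ {c = c} {d} e =
  (λ i → subst (λ z → isPos (c i) ≤ᵇ isPos z) (sym (e i)) (isPos-+ (c i) (d i))) ,
  (λ i → subst (λ z → isPos (d i) ≤ᵇ isPos z) (trans (ℕₚ.+-comm (d i) (c i)) (sym (e i))) (isPos-+ (d i) (c i)))

Bset-support : ∀ {n k} (c : Gates (Fin n) BOp k) r {b} → eval BLit BOpSet c r b →
  eval monLit boolOp c r (support b) ≡ true
Bset-support c (inj₁ i) e = cong isPos (trans (e i) (unitVec-same i))
Bset-support (c ▷ gate OR r₁ r₂) (inj₂ zero) {b} bb =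
  or-true⁺ (eval monLit boolOp c r₁) (eval monLit boolOp c r₂) (support b)
    ([ inj₁ ∘ Bset-support c r₁ , inj₂ ∘ Bset-support c r₂ ]′ bb)
Bset-support (c ▷ gate AND r₁ r₂) (inj₂ zero) {b} (x , y , bx , by , e) =
  and-true⁺ (eval monLit boolOp c r₁) (eval monLit boolOp c r₂) (support b)
    (≤ᵇ-true (eval-monotone c r₁ _ _ (proj₁ (support-+ᵥ e))) (Bset-support c r₁ bx))
    (≤ᵇ-true (eval-monotone c r₂ _ _ (proj₂ (support-+ᵥ e))) (Bset-support c r₂ by))
Bset-support (c ▷ gate _ _ _) (inj₂ (suc j)) = Bset-support c (inj₂ j)

module Prune {n : ℕ} where

  step : ∀ {k} → BOp → Poly n → Poly n → Ref (Fin n) k → Ref (Fin n) k →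
    Ref (Fin n) k ⊎ (AOp × Ref (Fin n) k × Ref (Fin n) k)
  step OR p₁ p₂ r₁ r₂ with ℕₚ.<-cmp (lowDegree p₁) (lowDegree p₂)
  ... | tri< _ _ _ = inj₁ r₁
  ... | tri≈ _ _ _ = inj₂ (PLUS , r₁ , r₂)
  ... | tri> _ _ _ = inj₁ r₂
  step AND _ _ r₁ r₂ = inj₂ (TIMES , r₁ , r₂)

  open Translation arLit (arOp ∘ toAOp) arLit arOp (Ref (Fin n)) weakenRef (inj₂ zero) inj₁ step

  LowestPartAt : Poly n → ∀ {k} → Gates (Fin n) AOp k → Ref (Fin n) k → Set
  LowestPartAt p c r = LowestPart p (eval arLit arOp c r)

  open Sound LowestPartAt (λ _ _ _ → ⊤) (λ _ _ _ → ⊤)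
    (λ {p} {_} {c} {g} {r} → subst (LowestPart p) (sym (eval-weakenRef arLit arOp c g r)))
    (λ i _ → LowestPart-input i)

  step-sound : StepSound
  step-sound OR p₁ p₂ c r₁ r₂ L₁ L₂ _ with ℕₚ.<-cmp (lowDegree p₁) (lowDegree p₂)
  ... | tri< lt _ _ = LowestPart-++ˡ L₁ L₂ lt
  ... | tri≈ _ eq _ = LowestPart-++ L₁ L₂ eq , tt
  ... | tri> _ _ gt = LowestPart-++ʳ L₁ L₂ gt
  step-sound AND p₁ p₂ c r₁ r₂ L₁ L₂ _ = LowestPart-*ₚ L₁ L₂ , tt

  -- Monomials of B_F lie above minimal true points of f, and all of Low(f) is in
  -- B_F; so the monomials of least degree in B_F are exactly Env(Low(f)).
  readOne⇒arithEnv : ∀ {f : BoolFun n} → Monotone f → ReadOneCircuits f ≼ ArithCircuits (Env (LowN f))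
  readOne⇒arithEnv {f} mf (circuit gs o , computes , readOne) =
    size , size≤ , circuit gs′ (node o) , λ a → Env⇒Occurs , Occurs⇒Env
    where
    open Translated (translate gs) renaming (gs to gs′)
    open ℕₚ using (≤-trans; ≤-antisym; ≤-reflexive)
    p = expPoly gs o
    q = poly (circuit gs′ (node o))
    L : LowestPart p q
    L = proj₂ (translate-sound step-sound gs (EveryGate-⊤ arLit (arOp ∘ toAOp) gs)) o
    p-least = LowestPart-least L
    below : ∀ {b} → Occurs b p → ∃[ x ] Low f x × weight x ≤ degree b × x ≤ᵥ support b
    below {b} ob =
      let (x , x≤ , lx) = Low-below (monotone⇒congruent mf) (support b)
                            (trans (sym (computes (support b))) (Bset-support gs o (Occurs⇒Bset gs o ob)))
      in x , lx , ≤-trans (weight-mono x≤) (weight-support b) , x≤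
    above : ∀ {x} → Low f x → lowDegree p ≤ weight x
    above lx = LeastDegree-Occurs p-least (Bset⇒Occurs gs o (readOne _ lx))
    lowest : ∃[ x ] Low f x × weight x ≤ lowDegree p
    lowest =
      let (m₀ , m₀∈ , dm₀) = proj₁ p-least ; (x , lx , wx≤ , _) = below (∈⇒Occurs m₀∈)
      in x , lx , ≤-trans wx≤ (≤-reflexive dm₀)
    Env⇒Occurs : ∀ {a} → Env (LowN f) a → Occurs a q
    Env⇒Occurs {a} ((x , lx , a≗) , minimal) =
      complete L oa (≤-antisym (≤-trans (minimal _ (x₀ , lx₀ , λ _ → refl)) wx₀≤) (LeastDegree-Occurs p-least oa))
      where
      oa : Occurs a p
      oa = Occurs-cong (≗ᵥ-sym a≗) (Bset⇒Occurs gs o (readOne x lx))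
      x₀ = proj₁ lowest
      lx₀ = proj₁ (proj₂ lowest)
      wx₀≤ = proj₂ (proj₂ lowest)
    -- weight (support a) ≤ degree a = lowDegree p ≤ weight x ≤ weight (support a)
    Occurs⇒Env : ∀ {a} → Occurs a q → Env (LowN f) a
    Occurs⇒Env {a} oq with sound L oq
    ... | oa , da with below oa
    ...   | x , lx , _ , x≤ = (x , lx , ≗ᵥ-trans a≗ (λ i → cong b2n (sym (x≗ i)))) ,
            λ b (x′ , lx′ , b≗) → ≤-trans (≤-reflexive da) (subst (lowDegree p ≤_) (sym (degree-cong b≗)) (above lx′))
      where
      a≤x : degree a ≤ weight x
      a≤x = ≤-trans (≤-reflexive da) (above lx)
      a≗ : a ≗ᵥ toNVec (support a)
      a≗ = weight-support-≡ a (≤-antisym (weight-support a) (≤-trans a≤x (weight-mono x≤)))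
      x≗ : x ≗ᵥ support a
      x≗ = weight-mono-≡ x≤ (≤-antisym (weight-mono x≤) (≤-trans (weight-support a) a≤x))

open Prune using (readOne⇒arithEnv)

-- An arithmetic circuit producing Low(f)

data Formula (n : ℕ) : Set where
  var  : Fin n → Formula n
  node : AOp → Formula n → Formula n → Formula n

formulaPoly : ∀ {n} → Formula n → Poly n
formulaPoly (var i)        = arLit i
formulaPoly (node o e₁ e₂) = arOp o (formulaPoly e₁) (formulaPoly e₂)

data _⊑G_ {L O : Set} : ∀ {k k'} → Gates L O k → Gates L O k' → Set where
  ⊑G-refl : ∀ {k} {c : Gates L O k} → c ⊑G c
  ⊑G-step : ∀ {k k'} {c : Gates L O k} {c' : Gates L O k'} {g} → c ⊑G c' → c ⊑G (c' ▷ g)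

⊑G-trans : ∀ {L O : Set} {k k' k''} {c : Gates L O k} {c' : Gates L O k'} {c'' : Gates L O k''} →
  c ⊑G c' → c' ⊑G c'' → c ⊑G c''
⊑G-trans e ⊑G-refl     = e
⊑G-trans e (⊑G-step e') = ⊑G-step (⊑G-trans e e')

weakenAlong : ∀ {L O : Set} {k k'} {c : Gates L O k} {c' : Gates L O k'} → c ⊑G c' → Ref L k → Ref L k'
weakenAlong ⊑G-refl     r = r
weakenAlong (⊑G-step e) r = weakenRef (weakenAlong e r)

eval-weakenAlong : ∀ {ℓ} {L O : Set} {D : Set ℓ} (lit : L → D) (op : O → D → D → D) {k k'}
  {c : Gates L O k} {c' : Gates L O k'} (e : c ⊑G c') r → eval lit op c' (weakenAlong e r) ≡ eval lit op c r
eval-weakenAlong lit op ⊑G-refl r = refl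
eval-weakenAlong lit op (⊑G-step {c' = c'} {g} e) r =
  trans (eval-weakenRef lit op c' g (weakenAlong e r)) (eval-weakenAlong lit op e r)

compile : ∀ {n k} (c : Gates (Fin n) AOp k) (e : Formula n) →
  ∃[ k' ] Σ (Gates (Fin n) AOp k') λ c' → c ⊑G c' × Σ (Ref (Fin n) k') λ r → eval arLit arOp c' r ≡ formulaPoly e
compile c (var i) = _ , c , ⊑G-refl , inj₁ i , refl
compile c (node o e₁ e₂) =
  let (k₁ , c₁ , c⊑c₁ , r₁ , p₁) = compile c e₁ ; (k₂ , c₂ , c₁⊑c₂ , r₂ , p₂) = compile c₁ e₂
  in suc k₂ , c₂ ▷ gate o (weakenAlong c₁⊑c₂ r₁) r₂ , ⊑G-step (⊑G-trans c⊑c₁ c₁⊑c₂) , inj₂ zero ,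
     cong₂ (arOp o) (trans (eval-weakenAlong arLit arOp c₁⊑c₂ r₁) p₁) p₂

formula⇒circuit : ∀ {n} (e : Formula n) → ∃[ s ] Σ (ArCircuit n s) λ C → poly C ≡ formulaPoly e
formula⇒circuit e = let (s , c , _ , r , p) = compile [] e in s , circuit c r , p

count : ∀ {n} → List (Fin n) → NVec n
count []       i = 0
count (j ∷ js) i = unitVec j i + count js i

productE : ∀ {n} → Fin n → List (Fin n) → Formula n
productE j []       = var j
productE j (k ∷ ks) = node TIMES (var j) (productE k ks)

formulaPoly-productE : ∀ {n} (j : Fin n) ks → ∃[ m ] formulaPoly (productE j ks) ≡ m ∷ [] × m ≗ᵥ count (j ∷ ks)
formulaPoly-productE j []       = unitVec j , refl , λ i → sym (ℕₚ.+-identityʳ _)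
formulaPoly-productE j (k ∷ ks) with formulaPoly-productE k ks
... | m , eq , m≗ rewrite eq = _ , refl , λ i → cong (unitVec j i +_) (m≗ i)

ones : ∀ {n} → BVec n → List (Fin n)
ones {zero}  a = []
ones {suc n} a = if a zero then zero ∷ map suc (ones (Vecᶠ.tail a)) else map suc (ones (Vecᶠ.tail a))

unitVec-suc : ∀ {n} (j i : Fin n) → unitVec (suc j) (suc i) ≡ unitVec j i
unitVec-suc j i with i ≟ j
... | yes _ = refl
... | no _  = refl

count-map-suc-zero : ∀ {n} (js : List (Fin n)) → count (map suc js) zero ≡ 0
count-map-suc-zero []       = refl
count-map-suc-zero (j ∷ js) = count-map-suc-zero js

count-map-suc : ∀ {n} (js : List (Fin n)) i → count (map suc js) (suc i) ≡ count js i
count-map-suc []       i = refl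
count-map-suc (j ∷ js) i = cong₂ _+_ (unitVec-suc j i) (count-map-suc js i)

count-ones : ∀ {n} (a : BVec n) → count (ones a) ≗ᵥ toNVec a
count-ones {suc n} a i with a zero in a₀
count-ones {suc n} a zero    | true  rewrite a₀ = cong suc (count-map-suc-zero (ones (Vecᶠ.tail a)))
count-ones {suc n} a (suc i) | true  = trans (count-map-suc (ones (Vecᶠ.tail a)) i) (count-ones (Vecᶠ.tail a) i)
count-ones {suc n} a zero    | false rewrite a₀ = count-map-suc-zero (ones (Vecᶠ.tail a))
count-ones {suc n} a (suc i) | false = trans (count-map-suc (ones (Vecᶠ.tail a)) i) (count-ones (Vecᶠ.tail a) i)

-- x^a as a formula; the variable j is a dummy used only when a has no ones,
-- and x^0 = 1 is no formula.
monomialE : ∀ {n} → Fin n → BVec n → Formula n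
monomialE j a with ones a
... | []     = var j
... | k ∷ ks = productE k ks

formulaPoly-monomialE : ∀ {n} (j : Fin n) {a} i → a i ≡ true →
  ∃[ m ] formulaPoly (monomialE j a) ≡ m ∷ [] × m ≗ᵥ toNVec a
formulaPoly-monomialE j {a} i ai with ones a | count-ones a
... | []     | c = contradiction (trans (c i) (cong b2n ai)) λ ()
... | k ∷ ks | c = let (m , eq , m≗) = formulaPoly-productE k ks in m , eq , ≗ᵥ-trans m≗ c

∷-≗ᵥ : ∀ {n} {A : Set} {x : Fin (suc n) → A} {b y} → b ≡ x zero → y ≗ᵥ Vecᶠ.tail x → (b Vecᶠ.∷ y) ≗ᵥ x
∷-≗ᵥ e e′ zero    = e
∷-≗ᵥ e e′ (suc i) = e′ i

allBVec : ∀ n → List (BVec n)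
allBVec zero    = Vecᶠ.[] ∷ []
allBVec (suc n) = map (false Vecᶠ.∷_) (allBVec n) ++ map (true Vecᶠ.∷_) (allBVec n)

allBVec-complete : ∀ {n} (x : BVec n) → Any (_≗ᵥ x) (allBVec n)
allBVec-complete {zero}  x = here (λ ())
allBVec-complete {suc n} x with x zero in x₀
... | false = Anyₚ.++⁺ˡ (Anyₚ.map⁺ (Any.map (∷-≗ᵥ (sym x₀)) (allBVec-complete (Vecᶠ.tail x))))
... | true  = Anyₚ.++⁺ʳ _ (Anyₚ.map⁺ (Any.map (∷-≗ᵥ (sym x₀)) (allBVec-complete (Vecᶠ.tail x))))

sumE : ∀ {n} {A : Set} → (A → Formula n) → (ys : List A) → NonEmpty ys → Formula n
sumE t (y ∷ [])      _ = t y
sumE t (y ∷ y′ ∷ ys) _ = node PLUS (t y) (sumE t (y′ ∷ ys) (y′ , here refl))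

Occurs-sumE⁻ : ∀ {n} {A : Set} (t : A → Formula n) ys (ne : NonEmpty ys) {m} →
  Occurs m (formulaPoly (sumE t ys ne)) → Any (λ y → Occurs m (formulaPoly (t y))) ys
Occurs-sumE⁻ t (y ∷ [])      _ o = here o
Occurs-sumE⁻ t (y ∷ y′ ∷ ys) _ o =
  [ here , there ∘ Occurs-sumE⁻ t (y′ ∷ ys) (y′ , here refl) ]′ (Anyₚ.++⁻ (formulaPoly (t y)) o)

Occurs-sumE⁺ : ∀ {n} {A : Set} (t : A → Formula n) ys (ne : NonEmpty ys) {m} →
  Any (λ y → Occurs m (formulaPoly (t y))) ys → Occurs m (formulaPoly (sumE t ys ne))
Occurs-sumE⁺ t (y ∷ [])      _ (here o) = o
Occurs-sumE⁺ t (y ∷ y′ ∷ ys) _ (here o) = Anyₚ.++⁺ˡ o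
Occurs-sumE⁺ t (y ∷ y′ ∷ ys) _ (there a) = Anyₚ.++⁺ʳ (formulaPoly (t y)) (Occurs-sumE⁺ t (y′ ∷ ys) (y′ , here refl) a)

-- Low(f) = Σ_{a ∈ Low(f)} x^a, written as a formula.
arithLow : ∀ {n} {f : BoolFun n} → Monotone f → NonConstant f → ∃ (ArithCircuits (LowN f))
arithLow {n} {f} mf (x₀ , y₀ , f≢) = s , C , λ a → Low⇒Occurs , Occurs⇒Low
  where
  cf = monotone⇒congruent mf
  lows = filter (Low? cf) (allBVec n)
  lows-Low : All (Low f) lows
  lows-Low = Allₚ.all-filter (Low? cf) (allBVec n)
  lows-complete : ∀ {x} → Low f x → Any (_≗ᵥ x) lows
  lows-complete {x} lx with Anyₚ.filter⁺ (Low? cf) (allBVec-complete x)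
  ... | inj₁ a   = a
  ... | inj₂ ¬ly = contradiction (Low-cong cf (≗ᵥ-sym (Anyₚ.lookup-result (allBVec-complete x))) lx) ¬ly
  some-true : ∃[ x ] f x ≡ true
  some-true with f x₀ in fx₀ | f y₀ in fy₀
  ... | true  | _     = x₀ , fx₀
  ... | false | true  = y₀ , fy₀
  ... | false | false = contradiction refl f≢
  f-allFalse : f allFalse ≢ true
  f-allFalse f0 = f≢ (trans (everywhere x₀) (sym (everywhere y₀)))
    where
    everywhere : ∀ x → f x ≡ true
    everywhere x = ≤ᵇ-true (mf allFalse x (allFalse-≤ x)) f0
  has-one : ∀ {y} → Low f y → ∃[ i ] y i ≡ true
  has-one {y} (fy , _) = decidable-stable (Finₚ.any? λ i → y i Boolₚ.≟ true) λ none →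
    f-allFalse (trans (cf λ i → sym (≢true⇒false (λ yi → none (i , yi)))) fy)
  first = Low-below cf (proj₁ some-true) (proj₂ some-true)
  j : Fin n
  j = proj₁ (has-one (proj₂ (proj₂ first)))
  lows-nonEmpty : NonEmpty lows
  lows-nonEmpty = let (y , y∈ , _) = find (lows-complete (proj₂ (proj₂ first))) in y , y∈
  term : BVec n → Formula n
  term = monomialE j
  formula = formula⇒circuit (sumE term lows lows-nonEmpty)
  s = proj₁ formula
  C = proj₁ (proj₂ formula)
  poly-C : poly C ≡ formulaPoly (sumE term lows lows-nonEmpty)
  poly-C = proj₂ (proj₂ formula)
  Occurs-term : ∀ {y} → Low f y → (∀ {m} → Occurs m (formulaPoly (term y)) → toNVec y ≗ᵥ m)
                                × (∀ {m} → toNVec y ≗ᵥ m → Occurs m (formulaPoly (term y)))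
  Occurs-term ly =
    let (i , yi) = has-one ly ; (m₀ , eq , m₀≗) = formulaPoly-monomialE j i yi
    in (λ o → ≗ᵥ-trans (≗ᵥ-sym m₀≗) (Occurs-singleton (subst (Occurs _) eq o)))
     , (λ e → subst (Occurs _) (sym eq) (here (≗ᵥ-trans m₀≗ e)))
  Low⇒Occurs : ∀ {a} → LowN f a → Occurs a (poly C)
  Low⇒Occurs (x , lx , a≗) = subst (Occurs _) (sym poly-C) (Occurs-sumE⁺ term lows lows-nonEmpty
    (Any.map (λ y≗x → proj₂ (Occurs-term (Low-cong cf (≗ᵥ-sym y≗x) lx)) λ i → trans (cong b2n (y≗x i)) (sym (a≗ i)))
             (lows-complete lx)))
  Occurs⇒Low : ∀ {a} → Occurs a (poly C) → LowN f a
  Occurs⇒Low o =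
    let (y , y∈ , oy) = find (Occurs-sumE⁻ term lows lows-nonEmpty (subst (Occurs _) poly-C o))
        ly = All.lookup lows-Low y∈
    in y , ly , ≗ᵥ-sym (proj₁ (Occurs-term ly) oy)

search-Ref : ∀ {L : Set} k → Searchable L → Searchable (Ref L k)
search-Ref k sL = search-⊎ sL (search-Fin k)

search-Gates : ∀ {L O : Set} k → Searchable L → Searchable O → Searchable (Gates L O k)
search-Gates zero    sL sO = search-onto search-Bool (λ _ → []) (λ { [] → true , refl })
search-Gates (suc k) sL sO =
  search-onto (search-Σ (search-Gates k sL sO) λ _ → search-Σ sO λ _ → search-Σ (search-Ref k sL) λ _ → search-Ref k sL)
    (λ (c , o , r₁ , r₂) → c ▷ gate o r₁ r₂) (λ { (c ▷ gate o r₁ r₂) → (c , o , r₁ , r₂) , refl })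

search-Circuit : ∀ {L O : Set} k → Searchable L → Searchable O → Searchable (Circuit L O k)
search-Circuit k sL sO =
  search-onto (search-Σ (search-Gates k sL sO) λ _ → search-Ref k sL)
    (λ (c , r) → circuit c r) (λ { (circuit c r) → (c , r) , refl })

search-BOp : Searchable BOp
search-BOp = search-onto search-Bool (λ b → if b then OR else AND) (λ { OR → true , refl ; AND → false , refl })

search-AOp : Searchable AOp
search-AOp = search-onto search-Bool (λ b → if b then PLUS else TIMES) (λ { PLUS → true , refl ; TIMES → false , refl })

search-Literal : ∀ n → Searchable (Literal n)
search-Literal n = search-Σ (search-Fin n) λ _ → search-Bool

Produces? : ∀ {n s} {A : NVec n → Set} → Extensional A → Decidable A → (∀ {a} → A a → ∃[ x ] a ≗ᵥ toNVec x) →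
  (C : ArCircuit n s) → Dec (Produces A C)
Produces? {n} {A = A} extA A? zeroOne C = map′ to from (all-in ×-dec All.all? A? (poly C))
  where
  all-in : Dec (∀ x → A (toNVec x) → Occurs (toNVec x) (poly C))
  all-in = ∀-BVec? n (λ x → A (toNVec x) → Occurs (toNVec x) (poly C))
    (λ e h ax′ → Occurs-cong (λ i → cong b2n (e i)) (h (extA (λ i → cong b2n (sym (e i))) ax′)))
    (λ x → A? (toNVec x) →-dec Occurs? (toNVec x) (poly C))
  to : _ → Produces A C
  to (h , all) a = (λ aa → let (x , e) = zeroOne aa in Occurs-cong (≗ᵥ-sym e) (h x (extA e aa))) ,
                   (λ o → let (m , m∈ , e) = find o in extA e (All.lookup all m∈))
  from : Produces A C → _
  from pr = (λ x ax → proj₁ (pr (toNVec x)) ax) , All.tabulate (λ {m} m∈ → proj₂ (pr m) (∈⇒Occurs m∈))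

module _ {n} {f : BoolFun n} (mf : Monotone f) where
  private
    cf = monotone⇒congruent mf

  ArithCircuits-LowN? : ∀ s → Dec (ArithCircuits (LowN f) s)
  ArithCircuits-LowN? s = search-Circuit s (search-Fin n) search-AOp _
    (Produces? (LowN-cong cf) (LowN? cf) λ (x , _ , e) → x , e)

  ArithCircuits-Env? : ∀ s → Dec (ArithCircuits (Env (LowN f)) s)
  ArithCircuits-Env? s = search-Circuit s (search-Fin n) search-AOp _
    (Produces? (Env-cong cf) (Env? cf) λ ((x , _ , e) , _) → x , e)

  monComputes? : ∀ {s} (C : MonCircuit n s) → Dec (Computes (monFun C) f)
  monComputes? C = Computes? (eval-congruent monLit-congruent (gates C) (out C)) cf

  MultilinearMonCircuits? : ∀ s → Dec (MultilinearMonCircuits f s)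
  MultilinearMonCircuits? s = search-Circuit s (search-Fin n) search-BOp _ λ C →
    monComputes? C ×-dec multilinear? monLit-congruent (gates C)

  MultilinearDMCircuits? : ∀ s → Dec (MultilinearDMCircuits f s)
  MultilinearDMCircuits? s = search-Circuit s (search-Literal n) search-BOp _ λ C →
    Computes? (eval-congruent dmLit-congruent (gates C) (out C)) cf ×-dec multilinear? dmLit-congruent (gates C)

  ReadOneCircuits? : ∀ s → Dec (ReadOneCircuits f s)
  ReadOneCircuits? s = search-Circuit s (search-Fin n) search-BOp _ λ C →
    monComputes? C ×-dec map′ (λ h a la → Occurs⇒Bset (gates C) (out C) (h a la))
                              (λ h a la → Bset⇒Occurs (gates C) (out C) (h a la))
      (∀-BVec? n (λ a → Low f a → Occurs (toNVec a) (expPoly (gates C) (out C)))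
        (λ e h la → Occurs-cong (λ i → cong b2n (e i)) (h (Low-cong cf (≗ᵥ-sym e) la)))
        (λ a → Low? cf a →-dec Occurs? _ _))

arithEnv⇒arithLow : ∀ {n} {f : BoolFun n} → Homogeneous f → ArithCircuits (Env (LowN f)) ≼ ArithCircuits (LowN f)
arithEnv⇒arithLow {f = f} hom {s} (C , produces) =
  s , ℕₚ.≤-refl , C , λ a → (λ la → proj₁ (produces a) (la , least-degree la)) , proj₁ ∘ proj₂ (produces a)
  where
  least-degree : ∀ {a} → LowN f a → ∀ b → LowN f b → degree a ≤ degree b
  least-degree (x , lx , a≗) b (y , ly , b≗) =
    ℕₚ.≤-reflexive (trans (degree-cong a≗) (trans (hom x y lx ly) (sym (degree-cong b≗))))

theorem4 : ∀ (n : ℕ) (f : BoolFun n) → Monotone f → NonConstant f →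
    ∃[ aEnv ] ∃[ r ] ∃[ l ] ∃[ m ] ∃[ aLow ]
      ( Arith (Env (LowN f)) aEnv × Read₁ f r × Lin f l × mLin f m × Arith (LowN f) aLow
      × aEnv ≤ r × r ≤ l × l ≡ m × m ≤ aLow
      × (Homogeneous f → (aLow ≡ r) × (r ≡ l) × (l ≡ m)) )
theorem4 n f mf nc =
  aEnv , r , l , m , aLow , isEnv , isR , isL , isM , isLow ,
  aEnv≤r , ≤-trans r≤m m≤l , l≡m , m≤aLow ,
  λ hom → ≤-antisym (aLow≤r hom) (≤-trans r≤m m≤aLow) ,
          ≤-antisym (≤-trans r≤m m≤l) (≤-trans l≤m (≤-trans m≤aLow (aLow≤r hom))) , l≡m
  where
  open ℕₚ using (≤-trans; ≤-antisym)
  Low′ = least _ (ArithCircuits-LowN? mf) (proj₂ (arithLow mf nc))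
  aLow = proj₁ Low′
  isLow = proj₂ Low′
  open LeastBelow (least-≼ (MultilinearMonCircuits? mf) (arith⇒multilinearMon mf) isLow)
    renaming (size to m; isMin to isM; below to m≤aLow)
  open LeastBelow (least-≼ (MultilinearDMCircuits? mf) multilinearMon⇒multilinearDM isM)
    renaming (size to l; isMin to isL; below to l≤m)
  open LeastBelow (least-≼ (ReadOneCircuits? mf) multilinearMon⇒readOne isM)
    renaming (size to r; isMin to isR; below to r≤m)
  open LeastBelow (least-≼ (ArithCircuits-Env? mf) (readOne⇒arithEnv mf) isR)
    renaming (size to aEnv; isMin to isEnv; below to aEnv≤r)
  m≤l = IsMin-≼ isL isM (multilinearDM⇒multilinearMon mf nc)
  l≡m = ≤-antisym l≤m m≤l
  aLow≤r = λ hom → ≤-trans (IsMin-≼ isEnv isLow (arithEnv⇒arithLow hom)) aEnv≤r
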